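{- Let $(D,X,H)$ be a constructible configuration. Then for each block $B$ of $D$ there is a uniquely determined cover $(X^B,H^B)$ of $B$ such that: (a) for each block $B$, $(B,X^B,H^B)$ is a K-configuration, a C-configuration, or a BC-configuration; (b) the digraphs $H^B$ ($B$ a block of $D$) are pairwise disjoint and $H=\bigcup_B H^B$; (c) for every $v\in V(D)$, $X_v=\bigcup_{B \ni v} X^B_v$, the union over all blocks $B$ of $D$ containing $v$.
   Context: Digraphs are finite, without loops and parallel arcs (opposite arcs allowed); connectivity means weak connectivity (connectivity of the underlying undirected graph). A separating vertex of a connected digraph $D$ is a vertex $v$ with $D-v$ disconnected; a block is a maximal subdigraph without a separating vertex. A cover of a digraph $D$ is a pair $(X,H)$: pairwise disjoint sets $X_v$ ($v\in V(D)$), and a digraph $H$ on $\bigcup_v X_v$ with each $X_v$ independent, such that for each arc $uv\in A(D)$ the arcs of $H$ from $X_u$ to $X_v$ form a (possibly empty) matching and every arc of $H$ arises in this way. A feasible configuration is a triple $(D,X,H)$ with $D$ connected and $(X,H)$ a cover of $D$. K-configuration: $D$ is a complete digraph (all ordered pairs of distinct vertices are arcs) on $n\ge1$ vertices, $|X_v|=n-1$ for all $v$, and there are labelings $X_v=\{x_v^1,\dots,x_v^{n-1}\}$ such that each $H^i=H[\{x_v^i: v\in V(D)\}]$ is a complete digraph and $H=H^1\cup\dots\cup H^{n-1}$ (for $n=1$, $X_v=\emptyset$ and $H$ is empty). C-configuration: $D$ is a directed cycle of length $n\ge 2$, $X_v=\{x_v\}$ for all $v$, and $A(H)=\{x_vx_u: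 vu\in A(D)\}$. Odd BC-configuration: $D$ is a bidirected cycle (a cycle with each edge replaced by two opposite arcs) of odd length $\ge5$, $|X_v|=2$ for all $v$, with labelings $X_v=\{x_v^1,x_v^2\}$ such that $A(H)=\{x_v^ix_w^i: vw\in A(D), i\in\{1,2\}\}$. Even BC-configuration: $D$ is a bidirected cycle of even length $\ge4$, $|X_v|=2$ for all $v$, and there is an arc $uu'\in A(D)$ and labelings $X_v=\{x_v^1,x_v^2\}$ such that $A(H)=\{x_v^ix_w^i: \{v,w\}\ne\{u,u'\}, vw\in A(D), i\in\{1,2\}\}\cup\{x_u^1x_{u'}^2,x_u^2x_{u'}^1,x_{u'}^2x_u^1,x_{u'}^1x_u^2\}$. A BC-configuration is an odd or even BC-configuration. Merging: given two feasible configurations $(D^1,X^1,H^1)$, $(D^2,X^2,H^2)$ with $V(D^1)\cap V(D^2)=\emptyset$ and $V(H^1)\cap V(H^2)=\emptyset$, and vertices $v^1\in V(D^1)$, $v^2\in V(D^2)$, let $D$ be obtained from $D^1\cup D^2$ by identifying $v^1,v^2$ into a new vertex $v^*$, let $H=H^1\cup H^2$, $X_{v^*}=X^1_{v^1}\cup X^2_{v^2}$, and $X_v=X^i_v$ for $v\in V(D^i)\setminus\{v^i\}$. The class of constructible configurations is the smallest class of feasible configurations containing all K-, C- and BC-configurations and closed under merging. -}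

module Defs where

open import Data.Nat using (ℕ; zero; suc; _+_; _*_; _∸_; _≤_; _≟_)
open import Data.Fin using (Fin; toℕ)
open import Data.List using (List)
open import Data.List.Membership.Propositional using (_∈_; _∉_)
open import Data.Product using (Σ; ∃; ∃₂; _×_; _,_; proj₁; proj₂; Σ-syntax; ∃-syntax)
open import Data.Sum using (_⊎_)
open import Data.Unit using (⊤)
open import Data.Empty using (⊥)
open import Function.Bundles using (_⇔_)
open import Function.Definitions using (Injective)
open import Relation.Nullary using (¬_; yes; no)
open import Relation.Binary.PropositionalEquality using (_≡_; _≢_)

-- Finite sets of names are lists of natural numbers, compared as sets.

_≋_ : {A : Set} → List A → List A → Set
l ≋ l' = ∀ x → (x ∈ l) ⇔ (x ∈ l')

-- Digraphs: finite vertex set, finite arc set (a set of ordered pairs,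
-- so no parallel arcs), no loops.  Vertex names are natural numbers.

record Digraph : Set where
  field
    V : List ℕ
    A : List (ℕ × ℕ)
    arc-ends : ∀ {u w} → (u , w) ∈ A → (u ∈ V) × (w ∈ V)
    loopless : ∀ {u} → (u , u) ∉ A
open Digraph public

_≅_ : Digraph → Digraph → Set
D ≅ D' = (V D ≋ V D') × (A D ≋ A D')

Sub : Digraph → Digraph → Set
Sub B D = (∀ {x} → x ∈ V B → x ∈ V D) × (∀ {a} → a ∈ A B → a ∈ A D)

-- Weak connectivity: walks in the underlying undirected graph using only
-- vertices satisfying P.

data Walk (D : Digraph) (P : ℕ → Set) : ℕ → ℕ → Set where
  stay : ∀ {u} → u ∈ V D → P u → Walk D P u u
  fwd  : ∀ {u w x} → (u , w) ∈ A D → P u → Walk D P w x → Walk D P u x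
  bwd  : ∀ {u w x} → (w , u) ∈ A D → P u → Walk D P w x → Walk D P u x

Connected : Digraph → Set
Connected D = (∃ λ u → u ∈ V D)
            × (∀ u w → u ∈ V D → w ∈ V D → Walk D (λ _ → ⊤) u w)

Separating : Digraph → ℕ → Set
Separating D v = (v ∈ V D) × ∃₂ λ u w → (u ∈ V D) × (w ∈ V D) × (u ≢ v) × (w ≢ v)
                 × ¬ Walk D (λ x → x ≢ v) u w

NoSepVertex : Digraph → Set
NoSepVertex D = ∀ v → ¬ Separating D v

IsBlock : Digraph → Digraph → Set
IsBlock D B = Sub B D × Connected B × NoSepVertex B
            × (∀ B' → Sub B B' → Sub B' D → Connected B' → NoSepVertex B' → Sub B' B)

-- Covers.  X v is the set X_v (only relevant for v ∈ V(D)).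

record IsCover (D : Digraph) (X : ℕ → List ℕ) (H : Digraph) : Set where
  field
    vertices : ∀ x → (x ∈ V H) ⇔ (∃ λ v → (v ∈ V D) × (x ∈ X v))
    disjoint : ∀ u v x → u ∈ V D → v ∈ V D → x ∈ X u → x ∈ X v → u ≡ v
    independent : ∀ v x y → v ∈ V D → x ∈ X v → y ∈ X v → (x , y) ∉ A H
    origin : ∀ x y → (x , y) ∈ A H →
             ∃₂ λ u w → ((u , w) ∈ A D) × (x ∈ X u) × (y ∈ X w)
    matching-out : ∀ u w → (u , w) ∈ A D → ∀ x y y' → x ∈ X u → y ∈ X w → y' ∈ X w →
                   (x , y) ∈ A H → (x , y') ∈ A H → y ≡ y'
    matching-in : ∀ u w → (u , w) ∈ A D → ∀ x x' y → x ∈ X u → x' ∈ X u → y ∈ X w →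
                  (x , y) ∈ A H → (x' , y) ∈ A H → x ≡ x'

Feasible : Digraph → (ℕ → List ℕ) → Digraph → Set
Feasible D X H = Connected D × IsCover D X H

Enumerates : {n : ℕ} → (Fin n → ℕ) → List ℕ → Set
Enumerates {n} f l = Injective _≡_ _≡_ f × (∀ i → f i ∈ l) × (∀ x → x ∈ l → ∃ λ i → f i ≡ x)

UnionVertices : Digraph → (ℕ → List ℕ) → Digraph → Set
UnionVertices D X H = ∀ x → (x ∈ V H) ⇔ (∃ λ v → (v ∈ V D) × (x ∈ X v))

Labeling : (k : ℕ) → Digraph → (ℕ → List ℕ) → (ℕ → Fin k → ℕ) → Set
Labeling k D X lab = ∀ v → v ∈ V D → Enumerates (lab v) (X v)

KConfig : Digraph → (ℕ → List ℕ) → Digraph → Set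
KConfig D X H = Σ[ n ∈ ℕ ] Σ[ f ∈ (Fin n → ℕ) ] Σ[ lab ∈ (ℕ → Fin (n ∸ 1) → ℕ) ]
  (1 ≤ n) × Enumerates f (V D)
  × (∀ u w → u ∈ V D → w ∈ V D → u ≢ w → (u , w) ∈ A D)
  × Labeling (n ∸ 1) D X lab
  -- H = H^1 ∪ ... ∪ H^{n-1}, H^i complete on {x_v^i : v ∈ V(D)}
  × UnionVertices D X H
  × (∀ x y → ((x , y) ∈ A H) ⇔
       (∃₂ λ u w → (u ∈ V D) × (w ∈ V D) × (u ≢ w)
         × ∃ λ i → (x ≡ lab u i) × (y ≡ lab w i)))

CycSucc : {n : ℕ} → Fin n → Fin n → Set
CycSucc {n} i j = (toℕ j ≡ suc (toℕ i)) ⊎ ((toℕ i ≡ n ∸ 1) × (toℕ j ≡ 0))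

DirectedCycle : (n : ℕ) → (Fin n → ℕ) → Digraph → Set
DirectedCycle n f D = (2 ≤ n) × Enumerates f (V D)
  × (∀ u w → ((u , w) ∈ A D) ⇔ (∃₂ λ i j → CycSucc i j × (u ≡ f i) × (w ≡ f j)))

-- D is a bidirected cycle of length n (n ≥ 3 is imposed where used)
BidirectedCycle : (n : ℕ) → (Fin n → ℕ) → Digraph → Set
BidirectedCycle n f D = Enumerates f (V D)
  × (∀ u w → ((u , w) ∈ A D) ⇔
       (∃₂ λ i j → (CycSucc i j ⊎ CycSucc j i) × (u ≡ f i) × (w ≡ f j)))

CConfig : Digraph → (ℕ → List ℕ) → Digraph → Set
CConfig D X H = Σ[ n ∈ ℕ ] Σ[ f ∈ (Fin n → ℕ) ] Σ[ g ∈ (ℕ → ℕ) ]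
  DirectedCycle n f D
  × (∀ v → v ∈ V D → ∀ x → (x ∈ X v) ⇔ (x ≡ g v))
  × UnionVertices D X H
  × (∀ x y → ((x , y) ∈ A H) ⇔
       (∃₂ λ v w → ((v , w) ∈ A D) × (x ≡ g v) × (y ≡ g w)))

i1 i2 : Fin 2
i1 = Fin.zero
  where import Data.Fin as Fin
i2 = Fin.suc Fin.zero
  where import Data.Fin as Fin

OddBCConfig : Digraph → (ℕ → List ℕ) → Digraph → Set
OddBCConfig D X H = Σ[ n ∈ ℕ ] Σ[ f ∈ (Fin n → ℕ) ] Σ[ lab ∈ (ℕ → Fin 2 → ℕ) ]
  (5 ≤ n) × (∃ λ k → n ≡ 2 * k + 1)
  × BidirectedCycle n f D
  × Labeling 2 D X lab
  × UnionVertices D X H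
  × (∀ x y → ((x , y) ∈ A H) ⇔
       (∃₂ λ v w → ((v , w) ∈ A D) × ∃ λ i → (x ≡ lab v i) × (y ≡ lab w i)))

EvenBCConfig : Digraph → (ℕ → List ℕ) → Digraph → Set
EvenBCConfig D X H = Σ[ n ∈ ℕ ] Σ[ f ∈ (Fin n → ℕ) ] Σ[ lab ∈ (ℕ → Fin 2 → ℕ) ]
  Σ[ u ∈ ℕ ] Σ[ u' ∈ ℕ ]
  (4 ≤ n) × (∃ λ k → n ≡ 2 * k)
  × BidirectedCycle n f D
  × ((u , u') ∈ A D)
  × Labeling 2 D X lab
  × UnionVertices D X H
  × (∀ x y → ((x , y) ∈ A H) ⇔
       ((∃₂ λ v w → ((v , w) ∈ A D)
           × ¬ (((v ≡ u) × (w ≡ u')) ⊎ ((v ≡ u') × (w ≡ u)))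
           × ∃ λ i → (x ≡ lab v i) × (y ≡ lab w i))
        ⊎ ((x ≡ lab u i1) × (y ≡ lab u' i2))
        ⊎ ((x ≡ lab u i2) × (y ≡ lab u' i1))
        ⊎ ((x ≡ lab u' i2) × (y ≡ lab u i1))
        ⊎ ((x ≡ lab u' i1) × (y ≡ lab u i2))))

BCConfig : Digraph → (ℕ → List ℕ) → Digraph → Set
BCConfig D X H = OddBCConfig D X H ⊎ EvenBCConfig D X H

ren : ℕ → ℕ → ℕ → ℕ
ren v s x with x ≟ v
... | yes _ = s
... | no _ = x

-- (D , X , H) is obtained by merging (D1,X1,H1) at v1 and (D2,X2,H2) at v2,
-- the identified vertex being the new vertex s
IsMerge : Digraph → (ℕ → List ℕ) → Digraph → Digraph → (ℕ → List ℕ) → Digraph →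
          ℕ → ℕ → ℕ → Digraph → (ℕ → List ℕ) → Digraph → Set
IsMerge D1 X1 H1 D2 X2 H2 v1 v2 s D X H =
  (∀ x → x ∈ V D1 → x ∉ V D2) × (∀ x → x ∈ V H1 → x ∉ V H2)
  × (v1 ∈ V D1) × (v2 ∈ V D2)
  × (s ∉ V D1) × (s ∉ V D2)
  × (∀ x → (x ∈ V D) ⇔ ((∃ λ y → (y ∈ V D1) × (x ≡ ren v1 s y))
                        ⊎ (∃ λ y → (y ∈ V D2) × (x ≡ ren v2 s y))))
  × (∀ x y → ((x , y) ∈ A D) ⇔
       ((∃₂ λ a b → ((a , b) ∈ A D1) × (x ≡ ren v1 s a) × (y ≡ ren v1 s b))
        ⊎ (∃₂ λ a b → ((a , b) ∈ A D2) × (x ≡ ren v2 s a) × (y ≡ ren v2 s b))))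
  × (∀ x → (x ∈ V H) ⇔ ((x ∈ V H1) ⊎ (x ∈ V H2)))
  × (∀ a → (a ∈ A H) ⇔ ((a ∈ A H1) ⊎ (a ∈ A H2)))
  × (∀ x → (x ∈ X s) ⇔ ((x ∈ X1 v1) ⊎ (x ∈ X2 v2)))
  × (∀ v → v ∈ V D1 → v ≢ v1 → X v ≋ X1 v)
  × (∀ v → v ∈ V D2 → v ≢ v2 → X v ≋ X2 v)

data Constructible : Digraph → (ℕ → List ℕ) → Digraph → Set where
  base-K  : ∀ {D X H} → Feasible D X H → KConfig D X H → Constructible D X H
  base-C  : ∀ {D X H} → Feasible D X H → CConfig D X H → Constructible D X H
  base-BC : ∀ {D X H} → Feasible D X H → BCConfig D X H → Constructible D X H
  merge   : ∀ {D1 X1 H1 D2 X2 H2 v1 v2 s D X H} →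
            Constructible D1 X1 H1 → Constructible D2 X2 H2 →
            IsMerge D1 X1 H1 D2 X2 H2 v1 v2 s D X H →
            Constructible D X H

SameCover : Digraph → (ℕ → List ℕ) → Digraph → (ℕ → List ℕ) → Digraph → Set
SameCover B X H X' H' = (∀ v → v ∈ V B → X v ≋ X' v) × (H ≅ H')

record BlockDecomposition (D : Digraph) (X : ℕ → List ℕ) (H : Digraph)
       (XB : Digraph → ℕ → List ℕ) (HB : Digraph → Digraph) : Set where
  field
    -- the family is a function of the block (as a subdigraph)
    well-defined : ∀ B B' → IsBlock D B → IsBlock D B' → B ≅ B' →
                   SameCover B (XB B) (HB B) (XB B') (HB B')
    cover : ∀ B → IsBlock D B → IsCover B (XB B) (HB B)
    typ : ∀ B → IsBlock D B →
          KConfig B (XB B) (HB B) ⊎ CConfig B (XB B) (HB B) ⊎ BCConfig B (XB B) (HB B)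
    pairwise-disjoint : ∀ B B' → IsBlock D B → IsBlock D B' → ¬ (B ≅ B') →
                        ∀ x → x ∈ V (HB B) → x ∉ V (HB B')
    union-V : ∀ x → (x ∈ V H) ⇔ (∃ λ B → IsBlock D B × (x ∈ V (HB B)))
    union-A : ∀ a → (a ∈ A H) ⇔ (∃ λ B → IsBlock D B × (a ∈ A (HB B)))
    union-X : ∀ v → v ∈ V D → ∀ x →
              (x ∈ X v) ⇔ (∃ λ B → IsBlock D B × (v ∈ V B) × (x ∈ XB B v))

module Submission where

-- We maintain a "piece decomposition" of (D, X, H): a list
-- of configurations (P, X^P, H^P) sitting inside D which are exactly the
-- blocks of D having an arc, pairwise determined by any common arc, with
-- disjoint H^P, and whose H^P and X^P_v together make up H and X_v.
--   * A basic configuration is its own (only) piece, since complete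
--     digraphs and cycles have no separating vertex; the one-vertex
--     K-configuration has no pieces.
--   * For a merge, the pieces are those of the two sides, renamed so that
--     v1 resp. v2 becomes the new vertex s.  The key point is that a
--     2-connected subdigraph of the merge lies on one side of s.
-- From a piece decomposition we read off the block decomposition (arcless
-- blocks are single vertices with the empty cover).  Uniqueness holds
-- because the cover of a block is recovered from (X, H) and the arcs of the
-- block: every vertex of a configuration's cover has an out-neighbour.
-- Renamings of vertices, under which all notions involved are invariant,
-- provide the glue.

open import Defs
open import Data.Nat using (ℕ; zero; suc; _+_; _∸_; _≤_; _<_; _≟_; _<?_; z≤n; s≤s)
open import Data.Nat.Properties as ℕ using (≤-refl; <⇒≤; ≤∧≢⇒<; <-≤-trans; ≤-<-trans; ≤-total; <-irrefl; +-suc; +-identityʳ; m≤m+n; m+[n∸m]≡n)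
open import Data.Fin using (Fin; toℕ; fromℕ<) renaming (zero to fzero; suc to fsuc)
open import Data.Fin.Properties using (toℕ-injective; toℕ<n; fromℕ<-toℕ; toℕ-fromℕ<)
open import Data.List using (List; []; _∷_; map; filter; _++_)
open import Data.List.Membership.Propositional using (_∈_; _∉_) renaming (find to find-∈; lose to lose-∈)
open import Data.List.Membership.Propositional.Properties using (∈-map⁺; ∈-map⁻; ∈-filter⁺; ∈-filter⁻; ∈-++⁺ˡ; ∈-++⁺ʳ; ∈-++⁻)
open import Data.List.Membership.DecPropositional _≟_ using () renaming (_∈?_ to _∈ℕ?_)
open import Data.List.Relation.Unary.Any using (here; there; any?)
open import Data.Maybe using (Maybe; just; nothing)
open import Data.Product using (∃; ∃₂; _×_; _,_; proj₁; proj₂; Σ-syntax)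
open import Data.Product.Properties using (≡-dec)
open import Data.Sum using (_⊎_; inj₁; inj₂; swap; [_,_])
open import Data.Sum.Function.Propositional using (_⊎-⇔_)
open import Data.Unit using (⊤; tt)
open import Data.Empty using (⊥; ⊥-elim)
open import Function.Bundles using (_⇔_; mk⇔; Equivalence)
open Equivalence using (to; from)
import Function.Properties.Equivalence as ⇔
open import Relation.Binary.Definitions using (DecidableEquality)
open import Relation.Nullary using (¬_; yes; no; Dec; ¬?)
open import Relation.Nullary.Decidable using (_×-dec_; map′)
open import Relation.Binary.PropositionalEquality using (_≡_; _≢_; refl; sym; trans; cong; subst; subst₂)
import Data.List.Relation.Binary.Subset.DecPropositional as DecSubset
import Data.Sum as Sum
import Data.Product as Prod

≋-refl : {A : Set} {l : List A} → l ≋ l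
≋-refl x = ⇔.refl

≋-sym : {A : Set} {l l' : List A} → l ≋ l' → l' ≋ l
≋-sym e x = ⇔.sym (e x)

≋-trans : {A : Set} {l l' l'' : List A} → l ≋ l' → l' ≋ l'' → l ≋ l''
≋-trans e f x = ⇔.trans (e x) (f x)

≋? : {A : Set} → DecidableEquality A → (l l' : List A) → Dec (l ≋ l')
≋? eq? l l' = map′ (λ (p , q) x → mk⇔ (p {x}) (q {x}))
                   (λ e → (λ {x} → to (e x)) , (λ {x} → from (e x)))
                   (l ⊆? l' ×-dec l' ⊆? l)
  where open DecSubset eq? using (_⊆?_)

≅-refl : ∀ {G} → G ≅ G
≅-refl = ≋-refl , ≋-refl

≅-sym : ∀ {G G'} → G ≅ G' → G' ≅ G
≅-sym (eV , eA) = ≋-sym eV , ≋-sym eA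

≅-trans : ∀ {G G' G''} → G ≅ G' → G' ≅ G'' → G ≅ G''
≅-trans (eV , eA) (eV' , eA') = ≋-trans eV eV' , ≋-trans eA eA'

≅? : (G G' : Digraph) → Dec (G ≅ G')
≅? G G' = ≋? _≟_ (V G) (V G') ×-dec ≋? (≡-dec _≟_ _≟_) (A G) (A G')

Sub-trans : ∀ {G G' G''} → Sub G G' → Sub G' G'' → Sub G G''
Sub-trans (sV , sA) (sV' , sA') = (λ m → sV' (sV m)) , (λ m → sA' (sA m))

≅⇒Sub : ∀ {G G'} → G ≅ G' → Sub G G'
≅⇒Sub (eV , eA) = (λ {x} → to (eV x)) , (λ {a} → to (eA a))

Sub-antisym : ∀ {G G'} → Sub G G' → Sub G' G → G ≅ G'
Sub-antisym (sV , sA) (sV' , sA') = (λ x → mk⇔ sV sV') , (λ a → mk⇔ sA sA')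

walk-start : ∀ {G P u w} → Walk G P u w → (u ∈ V G) × P u
walk-start     (stay u∈ p)  = u∈ , p
walk-start {G} (fwd a p _) = proj₁ (arc-ends G a) , p
walk-start {G} (bwd a p _) = proj₂ (arc-ends G a) , p

walk-++ : ∀ {G P u w x} → Walk G P u w → Walk G P w x → Walk G P u x
walk-++ (stay _ _) W' = W'
walk-++ (fwd a p W) W' = fwd a p (walk-++ W W')
walk-++ (bwd a p W) W' = bwd a p (walk-++ W W')

walk-rev : ∀ {G P u w} → Walk G P u w → Walk G P w u
walk-rev (stay u∈ p) = stay u∈ p
walk-rev {G} (fwd a p W) =
  walk-++ (walk-rev W) (bwd a (proj₂ (walk-start W)) (stay (proj₁ (arc-ends G a)) p))
walk-rev {G} (bwd a p W) =
  walk-++ (walk-rev W) (fwd a (proj₂ (walk-start W)) (stay (proj₂ (arc-ends G a)) p))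

walk-map : ∀ {G G' P Q} (φ : ℕ → ℕ) →
  (∀ {x} → x ∈ V G → φ x ∈ V G') →
  (∀ {a b} → (a , b) ∈ A G → (φ a , φ b) ∈ A G') →
  (∀ {x} → x ∈ V G → P x → Q (φ x)) →
  ∀ {u w} → Walk G P u w → Walk G' Q (φ u) (φ w)
walk-map φ φV φA φP (stay u∈ p) = stay (φV u∈) (φP u∈ p)
walk-map {G} φ φV φA φP (fwd a p W) = fwd (φA a) (φP (proj₁ (arc-ends G a)) p) (walk-map φ φV φA φP W)
walk-map {G} φ φV φA φP (bwd a p W) = bwd (φA a) (φP (proj₂ (arc-ends G a)) p) (walk-map φ φV φA φP W)

arcless-walk : ∀ {G P u w} → (∀ a → a ∉ A G) → Walk G P u w → u ≡ w
arcless-walk noA (stay _ _)  = refl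
arcless-walk noA (fwd a _ _) = ⊥-elim (noA _ a)
arcless-walk noA (bwd a _ _) = ⊥-elim (noA _ a)

ren-eq : ∀ v s → ren v s v ≡ s
ren-eq v s with v ≟ v
... | yes _ = refl
... | no v≢v = ⊥-elim (v≢v refl)

ren-neq : ∀ v s x → x ≢ v → ren v s x ≡ x
ren-neq v s x x≢v with x ≟ v
... | yes x≡v = ⊥-elim (x≢v x≡v)
... | no _ = refl

ren-inv : ∀ v s y → y ≢ s → ren s v (ren v s y) ≡ y
ren-inv v s y y≢s with y ≟ v
... | yes refl = ren-eq s y
... | no _ = ren-neq s v y y≢s

ren-fixes : ∀ v s y → ren v s y ≢ s → ren v s y ≡ y
ren-fixes v s y ne with y ≟ v
... | yes _ = ⊥-elim (ne refl)
... | no _ = refl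

ren-moves : ∀ v s y → ren v s y ≢ s → y ≢ v
ren-moves v s y ne refl = ne (ren-eq v s)

record Ren (ρ σ : ℕ → ℕ) (G G' : Digraph) : Set where
  field
    inv   : ∀ {y} → y ∈ V G → σ (ρ y) ≡ y
    vimg⁺ : ∀ {y} → y ∈ V G → ρ y ∈ V G'
    vimg⁻ : ∀ {x} → x ∈ V G' → ∃ λ y → y ∈ V G × x ≡ ρ y
    aimg⁺ : ∀ {y z} → (y , z) ∈ A G → (ρ y , ρ z) ∈ A G'
    aimg⁻ : ∀ {a b} → (a , b) ∈ A G' → ∃₂ λ y z → (y , z) ∈ A G × a ≡ ρ y × b ≡ ρ z

module RenProps {ρ σ G G'} (R : Ren ρ σ G G') where
  open Ren R public

  ρσ : ∀ {x} → x ∈ V G' → ρ (σ x) ≡ x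
  ρσ x∈ with vimg⁻ x∈
  ... | y , y∈ , refl = cong ρ (inv y∈)

  σV : ∀ {x} → x ∈ V G' → σ x ∈ V G
  σV x∈ with vimg⁻ x∈
  ... | y , y∈ , refl = subst (_∈ V G) (sym (inv y∈)) y∈

  σ-inj : ∀ {x x'} → x ∈ V G' → x' ∈ V G' → σ x ≡ σ x' → x ≡ x'
  σ-inj p q e = trans (sym (ρσ p)) (trans (cong ρ e) (ρσ q))

  ρ-inj : ∀ {y y'} → y ∈ V G → y' ∈ V G → ρ y ≡ ρ y' → y ≡ y'
  ρ-inj p q e = trans (sym (inv p)) (trans (cong σ e) (inv q))

  σA : ∀ {a b} → (a , b) ∈ A G' → (σ a , σ b) ∈ A G
  σA m with aimg⁻ m
  ... | y , z , yz , refl , refl =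
    subst₂ (λ a b → (a , b) ∈ A G) (sym (inv (proj₁ (arc-ends G yz)))) (sym (inv (proj₂ (arc-ends G yz)))) yz

loopfree? : (a : ℕ × ℕ) → Dec (proj₁ a ≢ proj₂ a)
loopfree? (a , b) = ¬? (a ≟ b)

onArc : (ℕ → ℕ) → ℕ × ℕ → ℕ × ℕ
onArc φ (a , b) = φ a , φ b

mapDg : (ℕ → ℕ) → Digraph → Digraph
mapDg φ G = record
  { V = map φ (V G)
  ; A = filter loopfree? (map φ² (A G))
  ; arc-ends = ends
  ; loopless = λ m → proj₂ (∈-filter⁻ loopfree? {xs = map φ² (A G)} m) refl }
  where
  φ² = onArc φ
  ends : ∀ {u w} → (u , w) ∈ filter loopfree? (map φ² (A G)) → (u ∈ map φ (V G)) × (w ∈ map φ (V G))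
  ends m with ∈-map⁻ φ² (proj₁ (∈-filter⁻ loopfree? m))
  ... | (y , z) , yz , refl = ∈-map⁺ φ (proj₁ (arc-ends G yz)) , ∈-map⁺ φ (proj₂ (arc-ends G yz))

mapRen : ∀ (ρ σ : ℕ → ℕ) G → (∀ {y} → y ∈ V G → σ (ρ y) ≡ y) → Ren ρ σ G (mapDg ρ G)
mapRen ρ σ G inv = record
  { inv = inv
  ; vimg⁺ = ∈-map⁺ ρ
  ; vimg⁻ = ∈-map⁻ ρ
  ; aimg⁺ = λ {y} {z} yz → ∈-filter⁺ loopfree? (∈-map⁺ ρ² yz)
                              (λ e → loopless G (subst (λ t → (y , t) ∈ A G) (sym (ρ-inj yz e)) yz))
  ; aimg⁻ = preimage }
  where
  ρ² = onArc ρ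
  ρ-inj : ∀ {y z} → (y , z) ∈ A G → ρ y ≡ ρ z → y ≡ z
  ρ-inj yz e = trans (sym (inv (proj₁ (arc-ends G yz)))) (trans (cong σ e) (inv (proj₂ (arc-ends G yz))))
  preimage : ∀ {a b} → (a , b) ∈ A (mapDg ρ G) → ∃₂ λ y z → (y , z) ∈ A G × a ≡ ρ y × b ≡ ρ z
  preimage m with ∈-map⁻ ρ² (proj₁ (∈-filter⁻ loopfree? m))
  ... | (y , z) , yz , refl = y , z , yz , refl , refl

idRen : ∀ {G G'} → G ≅ G' → Ren (λ x → x) (λ x → x) G G'
idRen (eV , eA) = record
  { inv = λ _ → refl
  ; vimg⁺ = λ {y} → to (eV y)
  ; vimg⁻ = λ {x} m → x , from (eV x) m , refl
  ; aimg⁺ = λ {y} {z} → to (eA (y , z))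
  ; aimg⁻ = λ {a} {b} m → a , b , from (eA (a , b)) m , refl , refl }

mapDg-≅ : ∀ φ {G G'} → G ≅ G' → mapDg φ G ≅ mapDg φ G'
mapDg-≅ φ {G} {G'} (eV , eA) = (λ x → mk⇔ (images eV) (images (≋-sym eV))) ,
                                (λ a → mk⇔ (arcs eA) (arcs (≋-sym eA)))
  where
  φ² = onArc φ
  images : ∀ {l l' : List ℕ} → l ≋ l' → ∀ {x} → x ∈ map φ l → x ∈ map φ l'
  images e m with ∈-map⁻ φ m
  ... | y , y∈ , refl = ∈-map⁺ φ (to (e y) y∈)
  arcs : ∀ {l l' : List (ℕ × ℕ)} → l ≋ l' → ∀ {a} → a ∈ filter loopfree? (map φ² l) → a ∈ filter loopfree? (map φ² l')
  arcs e m with ∈-filter⁻ loopfree? {xs = map φ² _} m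
  ... | m' , nl with ∈-map⁻ φ² m'
  ... | y , y∈ , refl = ∈-filter⁺ loopfree? (∈-map⁺ φ² (to (e y) y∈)) nl

Config : Digraph → (ℕ → List ℕ) → Digraph → Set
Config D X H = KConfig D X H ⊎ CConfig D X H ⊎ BCConfig D X H

module Transport {ρ σ G G'} (R : Ren ρ σ G G') where
  open RenProps R

  connected : Connected G → Connected G'
  connected ((y , y∈) , walks) = (ρ y , vimg⁺ y∈) , λ u w u∈ w∈ →
    subst₂ (Walk G' (λ _ → ⊤)) (ρσ u∈) (ρσ w∈)
      (walk-map ρ vimg⁺ aimg⁺ (λ _ _ → tt) (walks (σ u) (σ w) (σV u∈) (σV w∈)))

  noSepVertex : NoSepVertex G → NoSepVertex G'
  noSepVertex ns v (v∈ , a , b , a∈ , b∈ , a≢v , b≢v , noWalk) =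
    ns (σ v) (σV v∈ , σ a , σ b , σV a∈ , σV b∈ ,
      (λ e → a≢v (σ-inj a∈ v∈ e)) , (λ e → b≢v (σ-inj b∈ v∈ e)) ,
      λ W → noWalk (subst₂ (Walk G' (λ x → x ≢ v)) (ρσ a∈) (ρσ b∈)
        (walk-map ρ vimg⁺ aimg⁺ (λ x∈ x≢σv e → x≢σv (trans (sym (inv x∈)) (cong σ e))) W)))

  hasArc : (∃ λ a → a ∈ A G) → ∃ λ a → a ∈ A G'
  hasArc ((y , z) , yz) = (ρ y , ρ z) , aimg⁺ yz

  σρ-intro : (P : ℕ → Set) {v : ℕ} → v ∈ V G → P v → P (σ (ρ v))
  σρ-intro P v∈ = subst P (sym (inv v∈))

  σρ-elim : (P : ℕ → Set) {v : ℕ} → v ∈ V G → P (σ (ρ v)) → P v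
  σρ-elim P v∈ = subst P (inv v∈)

  arcs-⇔ : (Ψ Ψ' : ℕ → ℕ → Set) →
    (∀ {v w} → (v , w) ∈ A G → Ψ v w → Ψ' (ρ v) (ρ w)) →
    (∀ {v w} → (v , w) ∈ A G' → Ψ' v w → Ψ (σ v) (σ w)) →
    (∃₂ λ v w → ((v , w) ∈ A G) × Ψ v w) ⇔ (∃₂ λ v w → ((v , w) ∈ A G') × Ψ' v w)
  arcs-⇔ Ψ Ψ' f g = mk⇔
    (λ (v , w , m , p) → ρ v , ρ w , aimg⁺ m , f m p)
    (λ (v , w , m , p) → σ v , σ w , σA m , g m p)

  distinct-⇔ : (Ψ Ψ' : ℕ → ℕ → Set) →
    (∀ {v w} → v ∈ V G → w ∈ V G → Ψ v w → Ψ' (ρ v) (ρ w)) →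
    (∀ {v w} → v ∈ V G' → w ∈ V G' → Ψ' v w → Ψ (σ v) (σ w)) →
    (∃₂ λ v w → (v ∈ V G) × (w ∈ V G) × (v ≢ w) × Ψ v w) ⇔
    (∃₂ λ v w → (v ∈ V G') × (w ∈ V G') × (v ≢ w) × Ψ' v w)
  distinct-⇔ Ψ Ψ' f g = mk⇔
    (λ (v , w , v∈ , w∈ , v≢w , p) → ρ v , ρ w , vimg⁺ v∈ , vimg⁺ w∈ , (λ e → v≢w (ρ-inj v∈ w∈ e)) , f v∈ w∈ p)
    (λ (v , w , v∈ , w∈ , v≢w , p) → σ v , σ w , σV v∈ , σV w∈ , (λ e → v≢w (σ-inj v∈ w∈ e)) , g v∈ w∈ p)

  enumerates : ∀ {n} {f : Fin n → ℕ} → Enumerates f (V G) → Enumerates (λ i → ρ (f i)) (V G')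
  enumerates {f = f} (f-inj , f-mem , f-onto) =
    (λ {i} {j} e → f-inj (ρ-inj (f-mem i) (f-mem j) e)) , (λ i → vimg⁺ (f-mem i)) , onto
    where
    onto : ∀ x → x ∈ V G' → ∃ λ i → ρ (f i) ≡ x
    onto x x∈ with vimg⁻ x∈
    ... | y , y∈ , refl with f-onto y y∈
    ... | i , refl = i , refl

  indexedArcs : ∀ {n} {f : Fin n → ℕ} (T : Fin n → Fin n → Set) →
    (∀ u w → ((u , w) ∈ A G) ⇔ (∃₂ λ i j → T i j × (u ≡ f i) × (w ≡ f j))) →
    (∀ u w → ((u , w) ∈ A G') ⇔ (∃₂ λ i j → T i j × (u ≡ ρ (f i)) × (w ≡ ρ (f j))))
  indexedArcs {f = f} T arcs u w = mk⇔ forth back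
    where
    forth : (u , w) ∈ A G' → ∃₂ λ i j → T i j × (u ≡ ρ (f i)) × (w ≡ ρ (f j))
    forth m with aimg⁻ m
    ... | y , z , yz , refl , refl with to (arcs y z) yz
    ... | i , j , t , refl , refl = i , j , t , refl , refl
    back : (∃₂ λ i j → T i j × (u ≡ ρ (f i)) × (w ≡ ρ (f j))) → (u , w) ∈ A G'
    back (i , j , t , refl , refl) = aimg⁺ (from (arcs (f i) (f j)) (i , j , t , refl , refl))

  -- vw is the arc aa' in one of its two directions (the twisted arc of an
  -- even BC-configuration); this is preserved and reflected by renaming
  IsTwist : ℕ → ℕ → ℕ → ℕ → Set
  IsTwist a a' v w = ((v ≡ a) × (w ≡ a')) ⊎ ((v ≡ a') × (w ≡ a))

  twist-ρ : ∀ {a a' v w} → a ∈ V G → a' ∈ V G → v ∈ V G → w ∈ V G →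
            IsTwist (ρ a) (ρ a') (ρ v) (ρ w) → IsTwist a a' v w
  twist-ρ a∈ a'∈ v∈ w∈ = Sum.map (Prod.map (ρ-inj v∈ a∈) (ρ-inj w∈ a'∈)) (Prod.map (ρ-inj v∈ a'∈) (ρ-inj w∈ a∈))

  twist-σ : ∀ {a a' v w} → v ∈ V G' → w ∈ V G' → IsTwist a a' (σ v) (σ w) → IsTwist (ρ a) (ρ a') v w
  twist-σ v∈ w∈ = Sum.map (Prod.map (ρ-of v∈) (ρ-of w∈)) (Prod.map (ρ-of v∈) (ρ-of w∈))
    where
    ρ-of : ∀ {z b} → z ∈ V G' → σ z ≡ b → z ≡ ρ b
    ρ-of z∈ e = trans (sym (ρσ z∈)) (cong ρ e)

  module _ {X : ℕ → List ℕ} {H : Digraph} where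
    X' : ℕ → List ℕ
    X' v = X (σ v)

    unionVertices : UnionVertices G X H → UnionVertices G' X' H
    unionVertices U x = mk⇔
      (λ m → let (y , y∈ , x∈) = to (U x) m in ρ y , vimg⁺ y∈ , σρ-intro (λ t → x ∈ X t) y∈ x∈)
      (λ (v , v∈ , x∈) → from (U x) (σ v , σV v∈ , x∈))

    cover : IsCover G X H → IsCover G' X' H
    cover C = record
      { vertices = unionVertices vertices
      ; disjoint = λ u v x u∈ v∈ xu xv → σ-inj u∈ v∈ (disjoint (σ u) (σ v) x (σV u∈) (σV v∈) xu xv)
      ; independent = λ v x y v∈ → independent (σ v) x y (σV v∈)
      ; origin = λ x y m → let (u , w , uw , xu , yw) = origin x y m in
          ρ u , ρ w , aimg⁺ uw , σρ-intro (λ t → x ∈ X t) (proj₁ (arc-ends G uw)) xu ,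
          σρ-intro (λ t → y ∈ X t) (proj₂ (arc-ends G uw)) yw
      ; matching-out = λ u w m → matching-out (σ u) (σ w) (σA m)
      ; matching-in = λ u w m → matching-in (σ u) (σ w) (σA m) }
      where open IsCover C

    kConfig : KConfig G X H → KConfig G' X' H
    kConfig (n , f , lab , 1≤n , en , complete , labels , U , arcsH) =
      n , (λ i → ρ (f i)) , (λ v → lab (σ v)) , 1≤n , enumerates en , complete' ,
      (λ v v∈ → labels (σ v) (σV v∈)) , unionVertices U ,
      λ x y → ⇔.trans (arcsH x y) (distinct-⇔ _ _
        (λ v∈ w∈ (i , ex , ey) → i , σρ-intro (λ t → x ≡ lab t i) v∈ ex , σρ-intro (λ t → y ≡ lab t i) w∈ ey)
        (λ _ _ p → p))
      where
      complete' : ∀ u w → u ∈ V G' → w ∈ V G' → u ≢ w → (u , w) ∈ A G'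
      complete' u w u∈ w∈ u≢w = subst₂ (λ a b → (a , b) ∈ A G') (ρσ u∈) (ρσ w∈)
        (aimg⁺ (complete (σ u) (σ w) (σV u∈) (σV w∈) (λ e → u≢w (σ-inj u∈ w∈ e))))

    cConfig : CConfig G X H → CConfig G' X' H
    cConfig (n , f , g , (2≤n , en , arcs) , Xv , U , arcsH) =
      n , (λ i → ρ (f i)) , (λ v → g (σ v)) , (2≤n , enumerates en , indexedArcs CycSucc arcs) ,
      (λ v v∈ → Xv (σ v) (σV v∈)) , unionVertices U ,
      λ x y → ⇔.trans (arcsH x y) (arcs-⇔ _ _
        (λ vw (ex , ey) → σρ-intro (λ t → x ≡ g t) (proj₁ (arc-ends G vw)) ex ,
                          σρ-intro (λ t → y ≡ g t) (proj₂ (arc-ends G vw)) ey)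
        (λ _ p → p))

    oddBCConfig : OddBCConfig G X H → OddBCConfig G' X' H
    oddBCConfig (n , f , lab , 5≤n , odd , (en , arcs) , labels , U , arcsH) =
      n , (λ i → ρ (f i)) , (λ v → lab (σ v)) , 5≤n , odd , (enumerates en , indexedArcs _ arcs) ,
      (λ v v∈ → labels (σ v) (σV v∈)) , unionVertices U ,
      λ x y → ⇔.trans (arcsH x y) (arcs-⇔ _ _
        (λ vw (i , ex , ey) → i , σρ-intro (λ t → x ≡ lab t i) (proj₁ (arc-ends G vw)) ex ,
                                  σρ-intro (λ t → y ≡ lab t i) (proj₂ (arc-ends G vw)) ey)
        (λ _ p → p))

    evenBCConfig : EvenBCConfig G X H → EvenBCConfig G' X' H
    evenBCConfig (n , f , lab , u , u' , 4≤n , even , (en , arcs) , uu' , labels , U , arcsH) =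
      n , (λ i → ρ (f i)) , (λ v → lab (σ v)) , ρ u , ρ u' , 4≤n , even , (enumerates en , indexedArcs _ arcs) ,
      aimg⁺ uu' , (λ v v∈ → labels (σ v) (σV v∈)) , unionVertices U ,
      λ x y → ⇔.trans (arcsH x y)
        (arcs-⇔ _ _ forth back ⊎-⇔ twisted i1 i2 u∈ u'∈ ⊎-⇔ twisted i2 i1 u∈ u'∈
                               ⊎-⇔ twisted i2 i1 u'∈ u∈ ⊎-⇔ twisted i1 i2 u'∈ u∈)
      where
      u∈ = proj₁ (arc-ends G uu')
      u'∈ = proj₂ (arc-ends G uu')
      forth : ∀ {x y v w} → (v , w) ∈ A G →
        (¬ IsTwist u u' v w × ∃ λ i → (x ≡ lab v i) × (y ≡ lab w i)) →
        (¬ IsTwist (ρ u) (ρ u') (ρ v) (ρ w) × ∃ λ i → (x ≡ lab (σ (ρ v)) i) × (y ≡ lab (σ (ρ w)) i))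
      forth {x} {y} vw (¬twist , i , ex , ey) =
        (λ t → ¬twist (twist-ρ u∈ u'∈ v∈ w∈ t)) ,
        i , σρ-intro (λ t → x ≡ lab t i) v∈ ex , σρ-intro (λ t → y ≡ lab t i) w∈ ey
        where
        v∈ = proj₁ (arc-ends G vw)
        w∈ = proj₂ (arc-ends G vw)
      back : ∀ {x y v w} → (v , w) ∈ A G' →
        (¬ IsTwist (ρ u) (ρ u') v w × ∃ λ i → (x ≡ lab (σ v) i) × (y ≡ lab (σ w) i)) →
        (¬ IsTwist u u' (σ v) (σ w) × ∃ λ i → (x ≡ lab (σ v) i) × (y ≡ lab (σ w) i))
      back vw (¬twist , p) =
        (λ t → ¬twist (twist-σ (proj₁ (arc-ends G' vw)) (proj₂ (arc-ends G' vw)) t)) , p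
      twisted : ∀ {x y a b} (i j : Fin 2) → a ∈ V G → b ∈ V G →
        ((x ≡ lab a i) × (y ≡ lab b j)) ⇔ ((x ≡ lab (σ (ρ a)) i) × (y ≡ lab (σ (ρ b)) j))
      twisted {x} {y} i j a∈ b∈ = mk⇔
        (Prod.map (σρ-intro (λ t → x ≡ lab t i) a∈) (σρ-intro (λ t → y ≡ lab t j) b∈))
        (Prod.map (σρ-elim (λ t → x ≡ lab t i) a∈) (σρ-elim (λ t → y ≡ lab t j) b∈))

    config : Config G X H → Config G' X' H
    config (inj₁ k) = inj₁ (kConfig k)
    config (inj₂ (inj₁ c)) = inj₂ (inj₁ (cConfig c))
    config (inj₂ (inj₂ (inj₁ o))) = inj₂ (inj₂ (inj₁ (oddBCConfig o)))
    config (inj₂ (inj₂ (inj₂ e))) = inj₂ (inj₂ (inj₂ (evenBCConfig e)))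

-- A digraph containing the arcs of a spanning cycle f 0 → f 1 → … → f n' → f 0
-- has no separating vertex: after deleting f K, the remaining vertices are
-- still joined along the cycle.  The cycle is indexed by ℕ (through h) so
-- that walks along intervals of indices can be built by induction.
module SpanningCycle (D : Digraph) (n' : ℕ) (f : Fin (suc n') → ℕ) (en : Enumerates f (V D))
                     (arc : ∀ i j → CycSucc i j → (f i , f j) ∈ A D) where
  n = suc n'

  h : ℕ → ℕ
  h m with m <? n
  ... | yes m<n = f (fromℕ< m<n)
  ... | no _ = 0

  h-fromℕ< : ∀ m (m<n : m < n) → h m ≡ f (fromℕ< m<n)
  h-fromℕ< m m<n with m <? n
  ... | yes m<n' = cong f (toℕ-injective (trans (toℕ-fromℕ< m<n') (sym (toℕ-fromℕ< m<n))))
  ... | no m≮n = ⊥-elim (m≮n m<n)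

  h-toℕ : ∀ i → h (toℕ i) ≡ f i
  h-toℕ i = trans (h-fromℕ< (toℕ i) (toℕ<n i)) (cong f (fromℕ<-toℕ i (toℕ<n i)))

  h-V : ∀ m → m < n → h m ∈ V D
  h-V m m<n = subst (_∈ V D) (sym (h-fromℕ< m m<n)) (proj₁ (proj₂ en) _)

  h-inj : ∀ m m' → m < n → m' < n → h m ≡ h m' → m ≡ m'
  h-inj m m' m<n m'<n e =
    trans (sym (toℕ-fromℕ< m<n))
      (trans (cong toℕ (proj₁ en (trans (sym (h-fromℕ< m m<n)) (trans e (h-fromℕ< m' m'<n)))))
        (toℕ-fromℕ< m'<n))

  h-step : ∀ m → suc m < n → (h m , h (suc m)) ∈ A D
  h-step m sm<n = subst₂ (λ a b → (a , b) ∈ A D) (sym (h-fromℕ< m m<n)) (sym (h-fromℕ< (suc m) sm<n))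
    (arc _ _ (inj₁ (trans (toℕ-fromℕ< sm<n) (cong suc (sym (toℕ-fromℕ< m<n))))))
    where m<n = <⇒≤ sm<n

  h-wrap : (h n' , h 0) ∈ A D
  h-wrap = subst₂ (λ a b → (a , b) ∈ A D) (sym (h-fromℕ< n' ≤-refl)) (sym (h-fromℕ< 0 (s≤s z≤n)))
    (arc _ _ (inj₂ (toℕ-fromℕ< {n'} {n} ≤-refl , toℕ-fromℕ< {0} {n} (s≤s z≤n))))

  module Avoiding (K : ℕ) (K<n : K < n) where
    P : ℕ → Set
    P x = x ≢ h K

    Misses : ℕ → ℕ → Set
    Misses a b = ∀ t → a ≤ t → t ≤ b → t ≢ K

    avoid : ∀ t → t < n → t ≢ K → P (h t)
    avoid t t<n t≢K e = t≢K (h-inj t K t<n K<n e)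

    along+ : ∀ d a → a + d < n → Misses a (a + d) → Walk D P (h a) (h (a + d))
    along+ zero a a+0<n misses = subst (λ t → Walk D P (h a) (h t)) (sym (+-identityʳ a))
      (stay (h-V a a<n) (avoid a a<n (misses a ≤-refl (m≤m+n a 0))))
      where a<n = subst (_< n) (+-identityʳ a) a+0<n
    along+ (suc d) a a+sd<n misses = fwd (h-step a sa<n) (avoid a (<⇒≤ sa<n) (misses a ≤-refl (m≤m+n a (suc d))))
      (subst (λ t → Walk D P (h (suc a)) (h t)) (sym (+-suc a d))
        (along+ d (suc a) (subst (_< n) (+-suc a d) a+sd<n)
          (λ t sa≤t t≤ → misses t (<⇒≤ sa≤t) (subst (t ≤_) (sym (+-suc a d)) t≤))))
      where
      sa<n : suc a < n
      sa<n = ≤-<-trans (subst (suc a ≤_) (sym (+-suc a d)) (s≤s (m≤m+n a d))) a+sd<n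

    along : ∀ a b → a ≤ b → b < n → Misses a b → Walk D P (h a) (h b)
    along a b a≤b b<n misses = subst (λ t → Walk D P (h a) (h t)) (m+[n∸m]≡n a≤b)
      (along+ (b ∸ a) a (subst (_< n) (sym (m+[n∸m]≡n a≤b)) b<n)
        (λ t a≤t t≤ → misses t a≤t (subst (t ≤_) (m+[n∸m]≡n a≤b) t≤)))

    -- if K lies between a and b, go the other way round the cycle
    walk-≤ : ∀ a b → a ≤ b → b < n → a ≢ K → b ≢ K → Walk D P (h a) (h b)
    walk-≤ a b a≤b b<n a≢K b≢K with K <? a | b <? K
    ... | yes K<a | _ = along a b a≤b b<n (λ t a≤t _ t≡K → <-irrefl (sym t≡K) (<-≤-trans K<a a≤t))
    ... | no _ | yes b<K = along a b a≤b b<n (λ t _ t≤b t≡K → <-irrefl t≡K (≤-<-trans t≤b b<K))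
    ... | no K≮a | no b≮K =
      walk-++ (walk-rev (along 0 a z≤n (≤-<-trans a≤b b<n) (λ t _ t≤a t≡K → <-irrefl t≡K (≤-<-trans t≤a a<K))))
        (bwd h-wrap (avoid 0 (s≤s z≤n) (λ 0≡K → <-irrefl 0≡K (≤-<-trans z≤n a<K)))
          (walk-rev (along b n' (ℕ.≤-pred b<n) ≤-refl (λ t b≤t _ t≡K → <-irrefl (sym t≡K) (<-≤-trans K<b b≤t)))))
      where
      a<K : a < K
      a<K = ≤∧≢⇒< (ℕ.≮⇒≥ K≮a) a≢K
      K<b : K < b
      K<b = ≤∧≢⇒< (ℕ.≮⇒≥ b≮K) (λ K≡b → b≢K (sym K≡b))

    walk : ∀ a b → a < n → b < n → a ≢ K → b ≢ K → Walk D P (h a) (h b)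
    walk a b a<n b<n a≢K b≢K with ≤-total a b
    ... | inj₁ a≤b = walk-≤ a b a≤b b<n a≢K b≢K
    ... | inj₂ b≤a = walk-rev (walk-≤ b a b≤a a<n b≢K a≢K)

  noSepVertex : NoSepVertex D
  noSepVertex v (v∈ , a , b , a∈ , b∈ , a≢v , b≢v , noWalk)
    with proj₂ (proj₂ en) v v∈ | proj₂ (proj₂ en) a a∈ | proj₂ (proj₂ en) b b∈
  ... | k , refl | i , refl | j , refl = noWalk
    (subst₂ (Walk D (λ x → x ≢ f k)) (h-toℕ i) (h-toℕ j)
      (subst (λ z → Walk D (λ x → x ≢ z) (h (toℕ i)) (h (toℕ j))) (h-toℕ k)
        (walk (toℕ i) (toℕ j) (toℕ<n i) (toℕ<n j)
          (λ e → a≢v (cong f (toℕ-injective e))) (λ e → b≢v (cong f (toℕ-injective e))))))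
    where open Avoiding (toℕ k) (toℕ<n k)

-- In a complete digraph any two vertices other than v are adjacent.
complete-noSepVertex : ∀ D → (∀ u w → u ∈ V D → w ∈ V D → u ≢ w → (u , w) ∈ A D) → NoSepVertex D
complete-noSepVertex D complete v (v∈ , a , b , a∈ , b∈ , a≢v , b≢v , noWalk) with a ≟ b
... | yes refl = noWalk (stay a∈ a≢v)
... | no a≢b = noWalk (fwd (complete a b a∈ b∈ a≢b) a≢v (stay b∈ b≢v))

successor : ∀ {n'} (i : Fin (suc n')) → ∃ λ j → CycSucc i j
successor {n'} i with suc (toℕ i) <? suc n'
... | yes si<n = fromℕ< si<n , inj₁ (toℕ-fromℕ< si<n)
... | no si≮n = fzero , inj₂ (ℕ.≤-antisym (ℕ.≤-pred (toℕ<n i)) (ℕ.≤-pred (ℕ.≮⇒≥ si≮n)) , refl)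

directedCycle-arc : ∀ {n f D} → DirectedCycle n f D → ∀ i j → CycSucc i j → (f i , f j) ∈ A D
directedCycle-arc {f = f} (_ , _ , arcs) i j c = from (arcs (f i) (f j)) (i , j , c , refl , refl)

bidirectedCycle-arc : ∀ {n f D} → BidirectedCycle n f D → ∀ i j → CycSucc i j → (f i , f j) ∈ A D
bidirectedCycle-arc {f = f} (_ , arcs) i j c = from (arcs (f i) (f j)) (i , j , inj₁ c , refl , refl)

config-noSepVertex : ∀ {D X H} → Config D X H → NoSepVertex D
config-noSepVertex {D} (inj₁ (_ , _ , _ , _ , _ , complete , _)) = complete-noSepVertex D complete
config-noSepVertex (inj₂ (inj₁ (zero , _ , _ , (() , _) , _)))
config-noSepVertex {D} (inj₂ (inj₁ (suc n' , f , _ , dc@(_ , en , _) , _))) =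
  SpanningCycle.noSepVertex D n' f en (directedCycle-arc {suc n'} {f} {D} dc)
config-noSepVertex (inj₂ (inj₂ (inj₁ (zero , _ , _ , () , _))))
config-noSepVertex {D} (inj₂ (inj₂ (inj₁ (suc n' , f , _ , _ , _ , bc@(en , _) , _)))) =
  SpanningCycle.noSepVertex D n' f en (bidirectedCycle-arc {suc n'} {f} {D} bc)
config-noSepVertex (inj₂ (inj₂ (inj₂ (zero , _ , _ , _ , _ , () , _))))
config-noSepVertex {D} (inj₂ (inj₂ (inj₂ (suc n' , f , _ , _ , _ , _ , _ , bc@(en , _) , _)))) =
  SpanningCycle.noSepVertex D n' f en (bidirectedCycle-arc {suc n'} {f} {D} bc)

-- In a configuration every vertex of H has an out-neighbour.  This is what
-- makes the cover of a block recoverable from (X, H) alone.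
HasOutArcs : Digraph → (ℕ → List ℕ) → Digraph → Set
HasOutArcs D X H = ∀ v x → v ∈ V D → x ∈ X v → ∃ λ y → (x , y) ∈ A H

anotherVertex : ∀ {m} (f : Fin (suc (suc m)) → ℕ) → (∀ {i j} → f i ≡ f j → i ≡ j) → ∀ v → ∃ λ i → f i ≢ v
anotherVertex f f-inj v with f fzero ≟ v
... | yes f0≡v = fsuc fzero , λ f1≡v → 0≢1 (f-inj (trans f0≡v (sym f1≡v)))
  where 0≢1 : fzero ≢ fsuc fzero
        0≢1 ()
... | no f0≢v = fzero , f0≢v

kConfig-out : ∀ {D X H} → KConfig D X H → HasOutArcs D X H
kConfig-out (zero , _ , _ , () , _)
kConfig-out (suc zero , _ , _ , _ , _ , _ , labels , _) v x v∈ x∈ with proj₂ (proj₂ (labels v v∈)) x x∈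
... | () , _
kConfig-out (suc (suc m) , f , lab , _ , (f-inj , f-mem , _) , _ , labels , _ , arcsH) v x v∈ x∈
  with proj₂ (proj₂ (labels v v∈)) x x∈ | anotherVertex f f-inj v
... | i , refl | j , fj≢v =
  lab (f j) i , from (arcsH _ _) (v , f j , v∈ , f-mem j , (λ v≡fj → fj≢v (sym v≡fj)) , i , refl , refl)

cConfig-out : ∀ {D X H} → CConfig D X H → HasOutArcs D X H
cConfig-out (zero , _ , _ , (() , _) , _)
cConfig-out {D} (suc n' , f , g , dc@(_ , (_ , _ , f-onto) , _) , Xv , _ , arcsH) v x v∈ x∈
  with f-onto v v∈ | to (Xv v v∈ x) x∈
... | i , refl | refl with successor i
... | j , i→j = g (f j) , from (arcsH _ _) (f i , f j , directedCycle-arc {suc n'} {f} {D} dc i j i→j , refl , refl)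

oddBCConfig-out : ∀ {D X H} → OddBCConfig D X H → HasOutArcs D X H
oddBCConfig-out (zero , _ , _ , () , _)
oddBCConfig-out {D} (suc n' , f , lab , _ , _ , bc@((_ , _ , f-onto) , _) , labels , _ , arcsH) v x v∈ x∈
  with f-onto v v∈ | proj₂ (proj₂ (labels v v∈)) x x∈
... | i , refl | l , refl with successor i
... | j , i→j = lab (f j) l , from (arcsH _ _) (f i , f j , bidirectedCycle-arc {suc n'} {f} {D} bc i j i→j , l , refl , refl)

-- in an even BC-configuration the two ends of the twisted arc are special
evenBCConfig-out : ∀ {D X H} → EvenBCConfig D X H → HasOutArcs D X H
evenBCConfig-out (zero , _ , _ , _ , _ , () , _)
evenBCConfig-out {D} {X} {H} (suc n' , f , lab , u , u' , _ , _ , bc@((_ , _ , f-onto) , _) , _ , labels , _ , arcsH) v x v∈ x∈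
  with proj₂ (proj₂ (labels v v∈)) x x∈
... | l , refl with v ≟ u | v ≟ u'
... | yes refl | _ = at-u l
  where
  at-u : ∀ l → ∃ λ y → (lab u l , y) ∈ A H
  at-u fzero = lab u' i2 , from (arcsH _ _) (inj₂ (inj₁ (refl , refl)))
  at-u (fsuc fzero) = lab u' i1 , from (arcsH _ _) (inj₂ (inj₂ (inj₁ (refl , refl))))
... | no _ | yes refl = at-u' l
  where
  at-u' : ∀ l → ∃ λ y → (lab u' l , y) ∈ A H
  at-u' fzero = lab u i2 , from (arcsH _ _) (inj₂ (inj₂ (inj₂ (inj₂ (refl , refl)))))
  at-u' (fsuc fzero) = lab u i1 , from (arcsH _ _) (inj₂ (inj₂ (inj₂ (inj₁ (refl , refl)))))
... | no v≢u | no v≢u' with f-onto v v∈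
... | i , refl with successor i
... | j , i→j = lab (f j) l , from (arcsH _ _) (inj₁ (f i , f j , bidirectedCycle-arc {suc n'} {f} {D} bc i j i→j ,
      [ (λ (e , _) → v≢u e) , (λ (e , _) → v≢u' e) ] , l , refl , refl))

config-out : ∀ {D X H} → Config D X H → HasOutArcs D X H
config-out {D} {X} {H} (inj₁ k) = kConfig-out {D} {X} {H} k
config-out {D} {X} {H} (inj₂ (inj₁ c)) = cConfig-out {D} {X} {H} c
config-out {D} {X} {H} (inj₂ (inj₂ (inj₁ o))) = oddBCConfig-out {D} {X} {H} o
config-out {D} {X} {H} (inj₂ (inj₂ (inj₂ e))) = evenBCConfig-out {D} {X} {H} e

Trivial : Digraph → (ℕ → List ℕ) → Digraph → Set
Trivial D X H = (∀ a → a ∉ A D) × (∀ v → v ∈ V D → ∀ x → x ∉ X v) × (∀ x → x ∉ V H) × (∀ a → a ∉ A H)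

config-arc-or-trivial : ∀ {D X H} → Config D X H → (∃ λ a → a ∈ A D) ⊎ Trivial D X H
config-arc-or-trivial (inj₁ (zero , _ , _ , () , _))
config-arc-or-trivial {D} {X} {H} (inj₁ (suc zero , f , lab , _ , (_ , _ , f-onto) , _ , labels , U , arcsH)) =
  inj₂ (noArc , noX , (λ x m → let (v , v∈ , x∈) = to (U x) m in noX v v∈ x x∈) , noArcH)
  where
  noArc : ∀ a → a ∉ A D
  noArc (u , w) uw with f-onto u (proj₁ (arc-ends D uw)) | f-onto w (proj₂ (arc-ends D uw))
  ... | fzero , refl | fzero , refl = loopless D uw
  noX : ∀ v → v ∈ V D → ∀ x → x ∉ X v
  noX v v∈ x x∈ with proj₂ (proj₂ (labels v v∈)) x x∈
  ... | () , _
  noArcH : ∀ a → a ∉ A H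
  noArcH (x , y) m with to (arcsH x y) m
  ... | _ , _ , _ , _ , _ , () , _
config-arc-or-trivial {D} (inj₁ (suc (suc m) , f , _ , _ , (f-inj , f-mem , _) , complete , _)) =
  inj₁ (_ , complete (f fzero) (f (fsuc fzero)) (f-mem _) (f-mem _) λ e → 0≢1 (f-inj e))
  where 0≢1 : fzero ≢ fsuc fzero
        0≢1 ()
config-arc-or-trivial (inj₂ (inj₁ (zero , _ , _ , (() , _) , _)))
config-arc-or-trivial {D} (inj₂ (inj₁ (suc n' , f , _ , dc , _))) =
  inj₁ (_ , directedCycle-arc {suc n'} {f} {D} dc fzero _ (proj₂ (successor fzero)))
config-arc-or-trivial (inj₂ (inj₂ (inj₁ (zero , _ , _ , () , _))))
config-arc-or-trivial {D} (inj₂ (inj₂ (inj₁ (suc n' , f , _ , _ , _ , bc , _)))) =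
  inj₁ (_ , bidirectedCycle-arc {suc n'} {f} {D} bc fzero _ (proj₂ (successor fzero)))
config-arc-or-trivial (inj₂ (inj₂ (inj₂ (zero , _ , _ , _ , _ , () , _))))
config-arc-or-trivial {D} (inj₂ (inj₂ (inj₂ (suc n' , f , _ , _ , _ , _ , _ , bc , _)))) =
  inj₁ (_ , bidirectedCycle-arc {suc n'} {f} {D} bc fzero _ (proj₂ (successor fzero)))

emptyDigraph : Digraph
emptyDigraph = record { V = [] ; A = [] ; arc-ends = λ () ; loopless = λ () }

emptyCover : ∀ B → IsCover B (λ _ → []) emptyDigraph
emptyCover B = record
  { vertices = λ x → mk⇔ (λ ()) (λ { (_ , _ , ()) })
  ; disjoint = λ _ _ _ _ _ ()
  ; independent = λ _ _ _ _ ()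
  ; origin = λ _ _ ()
  ; matching-out = λ _ _ _ _ _ _ ()
  ; matching-in = λ _ _ _ _ _ _ () }

arcless-kConfig : ∀ B → Connected B → (∀ a → a ∉ A B) → KConfig B (λ _ → []) emptyDigraph
arcless-kConfig B ((v₀ , v₀∈) , walks) noArc =
  1 , (λ _ → v₀) , (λ _ ()) , s≤s z≤n ,
  ((λ { {fzero} {fzero} _ → refl }) , (λ _ → v₀∈) , (λ x x∈ → fzero , same v₀∈ x∈)) ,
  (λ u w u∈ w∈ u≢w → ⊥-elim (u≢w (trans (sym (same v₀∈ u∈)) (same v₀∈ w∈)))) ,
  (λ _ _ → (λ { {()} }) , (λ ()) , (λ _ ())) ,
  (λ x → mk⇔ (λ ()) (λ { (_ , _ , ()) })) ,
  (λ x y → mk⇔ (λ ()) (λ { (_ , _ , _ , _ , _ , () , _) }))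
  where
  same : ∀ {u w} → u ∈ V B → w ∈ V B → u ≡ w
  same {u} {w} u∈ w∈ = arcless-walk noArc (walks u w u∈ w∈)

record Piece : Set where
  constructor piece
  field
    P : Digraph
    XP : ℕ → List ℕ
    HP : Digraph
open Piece public

record IsPiece (D : Digraph) (p : Piece) : Set where
  field
    sub : Sub (P p) D
    conf : Config (P p) (XP p) (HP p)
    cover : IsCover (P p) (XP p) (HP p)
    connected : Connected (P p)
    arc : ∃ λ a → a ∈ A (P p)

record PieceDecomposition (D : Digraph) (X : ℕ → List ℕ) (H : Digraph) : Set where
  field
    pieces : List Piece
    isPiece : ∀ {p} → p ∈ pieces → IsPiece D p
    connectedD : Connected D
    maximal : ∀ C → Sub C D → Connected C → NoSepVertex C → (∃ λ a → a ∈ A C) →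
              ∃ λ p → (p ∈ pieces) × Sub C (P p)
    arc-unique : ∀ {p q} → p ∈ pieces → q ∈ pieces → ∀ a → a ∈ A (P p) → a ∈ A (P q) →
                 (P p ≅ P q) × SameCover (P p) (XP p) (HP p) (XP q) (HP q)
    H-disjoint : ∀ {p q} → p ∈ pieces → q ∈ pieces → ¬ (P p ≅ P q) →
                 ∀ x → x ∈ V (HP p) → x ∉ V (HP q)
    union-V : ∀ x → (x ∈ V H) ⇔ (∃ λ p → (p ∈ pieces) × (x ∈ V (HP p)))
    union-A : ∀ a → (a ∈ A H) ⇔ (∃ λ p → (p ∈ pieces) × (a ∈ A (HP p)))
    union-X : ∀ v → v ∈ V D → ∀ x → (x ∈ X v) ⇔ (∃ λ p → (p ∈ pieces) × (v ∈ V (P p)) × (x ∈ XP p v))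

basic-decomposition : ∀ {D X H} → Feasible D X H → Config D X H → PieceDecomposition D X H
basic-decomposition {D} {X} {H} (connD , coverD) cf with config-arc-or-trivial {D} {X} {H} cf
... | inj₂ (noArc , noX , noVH , noAH) = record
  { pieces = []
  ; isPiece = λ ()
  ; connectedD = connD
  ; maximal = λ C subC _ _ (a , a∈) → ⊥-elim (noArc a (proj₂ subC a∈))
  ; arc-unique = λ ()
  ; H-disjoint = λ ()
  ; union-V = λ x → mk⇔ (λ m → ⊥-elim (noVH x m)) (λ { (_ , () , _) })
  ; union-A = λ a → mk⇔ (λ m → ⊥-elim (noAH a m)) (λ { (_ , () , _) })
  ; union-X = λ v v∈ x → mk⇔ (λ m → ⊥-elim (noX v v∈ x m)) (λ { (_ , () , _) }) }
... | inj₁ arcD = record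
  { pieces = whole ∷ []
  ; isPiece = λ { (here refl) → isPieceWhole }
  ; connectedD = connD
  ; maximal = λ C subC _ _ _ → whole , here refl , subC
  ; arc-unique = λ { (here refl) (here refl) _ _ _ → ≅-refl {D} , (λ _ _ → ≋-refl) , ≅-refl {H} }
  ; H-disjoint = λ { (here refl) (here refl) ne → ⊥-elim (ne (≅-refl {D})) }
  ; union-V = λ x → mk⇔ (λ m → whole , here refl , m) (λ { (_ , here refl , m) → m })
  ; union-A = λ a → mk⇔ (λ m → whole , here refl , m) (λ { (_ , here refl , m) → m })
  ; union-X = λ v v∈ x → mk⇔ (λ m → whole , here refl , v∈ , m) (λ { (_ , here refl , _ , m) → m }) }
  where
  whole = piece D X H
  isPieceWhole : IsPiece D whole
  isPieceWhole = record { sub = (λ z → z) , (λ z → z) ; conf = cf ; cover = coverD ; connected = connD ; arc = arcD }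

-- The data of a merge under named fields (IsMerge is a bare tuple).
record Merging (D1 : Digraph) (X1 : ℕ → List ℕ) (H1 D2 : Digraph) (X2 : ℕ → List ℕ) (H2 : Digraph)
               (v1 v2 s : ℕ) (D : Digraph) (X : ℕ → List ℕ) (H : Digraph) : Set where
  field
    disjointV : ∀ x → x ∈ V D1 → x ∉ V D2
    disjointH : ∀ x → x ∈ V H1 → x ∉ V H2
    v1∈ : v1 ∈ V D1
    v2∈ : v2 ∈ V D2
    s∉D1 : s ∉ V D1
    s∉D2 : s ∉ V D2
    vertices : ∀ x → (x ∈ V D) ⇔ ((∃ λ y → (y ∈ V D1) × (x ≡ ren v1 s y))
                                 ⊎ (∃ λ y → (y ∈ V D2) × (x ≡ ren v2 s y)))
    arcs : ∀ x y → ((x , y) ∈ A D) ⇔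
             ((∃₂ λ a b → ((a , b) ∈ A D1) × (x ≡ ren v1 s a) × (y ≡ ren v1 s b))
              ⊎ (∃₂ λ a b → ((a , b) ∈ A D2) × (x ≡ ren v2 s a) × (y ≡ ren v2 s b)))
    verticesH : ∀ x → (x ∈ V H) ⇔ ((x ∈ V H1) ⊎ (x ∈ V H2))
    arcsH : ∀ a → (a ∈ A H) ⇔ ((a ∈ A H1) ⊎ (a ∈ A H2))
    X-at-s : ∀ x → (x ∈ X s) ⇔ ((x ∈ X1 v1) ⊎ (x ∈ X2 v2))
    X-on-D1 : ∀ v → v ∈ V D1 → v ≢ v1 → X v ≋ X1 v
    X-on-D2 : ∀ v → v ∈ V D2 → v ≢ v2 → X v ≋ X2 v

toMerging : ∀ {D1 X1 H1 D2 X2 H2 v1 v2 s D X H} →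
  IsMerge D1 X1 H1 D2 X2 H2 v1 v2 s D X H → Merging D1 X1 H1 D2 X2 H2 v1 v2 s D X H
toMerging (dV , dH , v1∈ , v2∈ , s∉1 , s∉2 , vs , as , vsH , asH , Xs , X1eq , X2eq) =
  record { disjointV = dV ; disjointH = dH ; v1∈ = v1∈ ; v2∈ = v2∈ ; s∉D1 = s∉1 ; s∉D2 = s∉2
         ; vertices = vs ; arcs = as ; verticesH = vsH ; arcsH = asH
         ; X-at-s = Xs ; X-on-D1 = X1eq ; X-on-D2 = X2eq }

swapMerging : ∀ {D1 X1 H1 D2 X2 H2 v1 v2 s D X H} →
  Merging D1 X1 H1 D2 X2 H2 v1 v2 s D X H → Merging D2 X2 H2 D1 X1 H1 v2 v1 s D X H
swapMerging M = record
  { disjointV = λ x x∈D2 x∈D1 → disjointV x x∈D1 x∈D2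
  ; disjointH = λ x x∈H2 x∈H1 → disjointH x x∈H1 x∈H2
  ; v1∈ = v2∈ ; v2∈ = v1∈ ; s∉D1 = s∉D2 ; s∉D2 = s∉D1
  ; vertices = λ x → ⇔.trans (vertices x) swap-⇔
  ; arcs = λ x y → ⇔.trans (arcs x y) swap-⇔
  ; verticesH = λ x → ⇔.trans (verticesH x) swap-⇔
  ; arcsH = λ a → ⇔.trans (arcsH a) swap-⇔
  ; X-at-s = λ x → ⇔.trans (X-at-s x) swap-⇔
  ; X-on-D1 = X-on-D2 ; X-on-D2 = X-on-D1 }
  where
  open Merging M
  swap-⇔ : ∀ {B C : Set} → (B ⊎ C) ⇔ (C ⊎ B)
  swap-⇔ = mk⇔ swap swap

renamePiece : ℕ → ℕ → Piece → Piece
renamePiece v s p = piece (mapDg (ren v s) (P p)) (λ w → XP p (ren s v w)) (HP p)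

-- Everything about one side (D1, X1, H1) of a merge, given a piece
-- decomposition of it; the other side is handled by swapping.
module MergeSide {D1 X1 H1 D2 X2 H2 v1 v2 s D X H} (M : Merging D1 X1 H1 D2 X2 H2 v1 v2 s D X H)
                 (I : PieceDecomposition D1 X1 H1) where
  open Merging M
  open PieceDecomposition I

  ρ σ : ℕ → ℕ
  ρ = ren v1 s
  σ = ren s v1

  rename : Piece → Piece
  rename = renamePiece v1 s

  ≢s : ∀ {y} → y ∈ V D1 → y ≢ s
  ≢s y∈ refl = s∉D1 y∈

  σρ : ∀ {y} → y ∈ V D1 → σ (ρ y) ≡ y
  σρ {y} y∈ = ren-inv v1 s y (≢s y∈)

  ρV : ∀ {y} → y ∈ V D1 → ρ y ∈ V D
  ρV {y} y∈ = from (vertices _) (inj₁ (y , y∈ , refl))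

  ρA : ∀ {y z} → (y , z) ∈ A D1 → (ρ y , ρ z) ∈ A D
  ρA {y} {z} yz = from (arcs _ _) (inj₁ (y , z , yz , refl , refl))

  meet-at-s : ∀ {y y'} → y ∈ V D1 → y' ∈ V D2 → ρ y ≡ ren v2 s y' → ρ y ≡ s
  meet-at-s {y} {y'} y∈ y'∈ e = cases (y ≟ v1) (y' ≟ v2)
    where
    cases : Dec (y ≡ v1) → Dec (y' ≡ v2) → ρ y ≡ s
    cases (yes y≡v1) _ = subst (λ t → ρ t ≡ s) (sym y≡v1) (ren-eq v1 s)
    cases (no _) (yes y'≡v2) = trans e (subst (λ t → ren v2 s t ≡ s) (sym y'≡v2) (ren-eq v2 s))
    cases (no y≢v1) (no y'≢v2) = ⊥-elim (disjointV y y∈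
      (subst (_∈ V D2) (trans (sym (ren-neq v2 s y' y'≢v2)) (trans (sym e) (ren-neq v1 s y y≢v1))) y'∈))

  rename-Ren : ∀ {p} → p ∈ pieces → Ren ρ σ (P p) (P (rename p))
  rename-Ren {p} m = mapRen ρ σ (P p) (λ y∈ → σρ (proj₁ (IsPiece.sub (isPiece m)) y∈))

  rename-isPiece : ∀ {p} → p ∈ pieces → IsPiece D (rename p)
  rename-isPiece {p} m = record
    { sub = (λ x∈ → let (y , y∈ , e) = vimg⁻ x∈ in subst (_∈ V D) (sym e) (ρV (subV y∈))) , subA
    ; conf = Transport.config R {XP p} {HP p} conf
    ; cover = Transport.cover R {XP p} {HP p} cover
    ; connected = Transport.connected R connected
    ; arc = Transport.hasArc R arc }
    where
    R = rename-Ren m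
    open RenProps R using (vimg⁻; aimg⁻)
    open IsPiece (isPiece m)
    subV = proj₁ sub
    subA : ∀ {a} → a ∈ A (P (rename p)) → a ∈ A D
    subA {a , b} ab with aimg⁻ ab
    ... | y , z , yz , refl , refl = ρA (proj₂ sub yz)

  rename-arc-unique : ∀ {p q} → p ∈ pieces → q ∈ pieces → ∀ a → a ∈ A (P (rename p)) → a ∈ A (P (rename q)) →
    (P (rename p) ≅ P (rename q)) × SameCover (P (rename p)) (XP (rename p)) (HP (rename p)) (XP (rename q)) (HP (rename q))
  rename-arc-unique {p} {q} mp mq _ ap aq with RenProps.aimg⁻ (rename-Ren mp) ap | RenProps.aimg⁻ (rename-Ren mq) aq
  ... | y , z , yz , refl , refl | y' , z' , yz' , ey , ez =
    mapDg-≅ ρ {P p} {P q} samePiece , (λ v v∈ → sameX (σ v) (RenProps.σV (rename-Ren mp) v∈)) , sameH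
    where
    subp = proj₁ (IsPiece.sub (isPiece mp))
    subq = proj₁ (IsPiece.sub (isPiece mq))
    y≡y' : y ≡ y'
    y≡y' = trans (sym (σρ (subp (proj₁ (arc-ends (P p) yz))))) (trans (cong σ ey) (σρ (subq (proj₁ (arc-ends (P q) yz')))))
    z≡z' : z ≡ z'
    z≡z' = trans (sym (σρ (subp (proj₂ (arc-ends (P p) yz))))) (trans (cong σ ez) (σρ (subq (proj₂ (arc-ends (P q) yz')))))
    same = arc-unique mp mq (y , z) yz (subst₂ (λ u w → (u , w) ∈ A (P q)) (sym y≡y') (sym z≡z') yz')
    samePiece = proj₁ same
    sameX = proj₁ (proj₂ same)
    sameH = proj₂ (proj₂ same)

  rename-H-disjoint : ∀ {p q} → p ∈ pieces → q ∈ pieces → ¬ (P (rename p) ≅ P (rename q)) →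
                      ∀ x → x ∈ V (HP p) → x ∉ V (HP q)
  rename-H-disjoint {p} {q} mp mq ne = H-disjoint mp mq (λ e → ne (mapDg-≅ ρ {P p} {P q} e))

  piece-V-H1 : ∀ {p} → p ∈ pieces → ∀ {x} → x ∈ V (HP p) → x ∈ V H1
  piece-V-H1 {p} m {x} x∈ = from (union-V x) (p , m , x∈)

  piece-A-H1 : ∀ {p} → p ∈ pieces → ∀ {a} → a ∈ A (HP p) → a ∈ A H1
  piece-A-H1 {p} m {a} a∈ = from (union-A a) (p , m , a∈)

  OnSide : ℕ → Set
  OnSide x = (x ≡ s) ⊎ ((x ∈ V D1) × (x ≢ v1))

  OnSide-σV : ∀ {x} → OnSide x → σ x ∈ V D1
  OnSide-σV (inj₁ refl) = subst (_∈ V D1) (sym (ren-eq s v1)) v1∈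
  OnSide-σV {x} (inj₂ (x∈ , _)) = subst (_∈ V D1) (sym (ren-neq s v1 x (≢s x∈))) x∈

  OnSide-ρσ : ∀ {x} → OnSide x → ρ (σ x) ≡ x
  OnSide-ρσ (inj₁ refl) = trans (cong ρ (ren-eq s v1)) (ren-eq v1 s)
  OnSide-ρσ {x} (inj₂ (x∈ , x≢v1)) = trans (cong ρ (ren-neq s v1 x (≢s x∈))) (ren-neq v1 s x x≢v1)

  OnSide-meet : ∀ {x y} → OnSide x → y ∈ V D2 → x ≡ ren v2 s y → x ≡ s
  OnSide-meet (inj₁ x≡s) _ _ = x≡s
  OnSide-meet {x} (inj₂ (x∈ , x≢v1)) y∈ e =
    trans (sym (ren-neq v1 s x x≢v1)) (meet-at-s x∈ y∈ (trans (ren-neq v1 s x x≢v1) e))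

  module OnThisSide (C : Digraph) (subC : Sub C D) (onSide : ∀ {x} → x ∈ V C → OnSide x) where
    C1 : Digraph
    C1 = mapDg σ C

    R : Ren σ ρ C C1
    R = mapRen σ ρ C (λ x∈ → OnSide-ρσ (onSide x∈))

    -- an arc of C cannot come from D2, since its ends would both be s
    C1-sub : Sub C1 D1
    C1-sub = (λ x∈ → let (y , y∈ , e) = RenProps.vimg⁻ R x∈ in subst (_∈ V D1) (sym e) (OnSide-σV (onSide y∈))) , subA
      where
      subA : ∀ {a} → a ∈ A C1 → a ∈ A D1
      subA {a , b} ab with RenProps.aimg⁻ R ab
      ... | y , z , yz , refl , refl with to (arcs y z) (proj₂ subC yz)
      ... | inj₁ (y' , z' , y'z' , ey , ez) = subst₂ (λ u w → (u , w) ∈ A D1)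
              (sym (trans (cong σ ey) (σρ (proj₁ (arc-ends D1 y'z')))))
              (sym (trans (cong σ ez) (σρ (proj₂ (arc-ends D1 y'z'))))) y'z'
      ... | inj₂ (y' , z' , y'z' , ey , ez) = ⊥-elim (loopless C (subst₂ (λ u w → (u , w) ∈ A C)
              (OnSide-meet (onSide (proj₁ (arc-ends C yz))) (proj₁ (arc-ends D2 y'z')) ey)
              (OnSide-meet (onSide (proj₂ (arc-ends C yz))) (proj₂ (arc-ends D2 y'z')) ez) yz))

    inside-piece : Connected C → NoSepVertex C → (∃ λ a → a ∈ A C) →
                   ∃ λ p → (p ∈ pieces) × Sub C (P (rename p))
    inside-piece conC nsC arcC with maximal C1 C1-sub (Transport.connected R conC)
                                      (Transport.noSepVertex R nsC) (Transport.hasArc R arcC)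
    ... | p , m , (subV , subA) = p , m , inV , inA
      where
      R' = rename-Ren m
      inV : ∀ {x} → x ∈ V C → x ∈ V (P (rename p))
      inV x∈ = subst (_∈ V (P (rename p))) (OnSide-ρσ (onSide x∈))
                 (RenProps.vimg⁺ R' (subV (RenProps.vimg⁺ R x∈)))
      inA : ∀ {a} → a ∈ A C → a ∈ A (P (rename p))
      inA {a , b} ab = subst₂ (λ u w → (u , w) ∈ A (P (rename p)))
        (OnSide-ρσ (onSide (proj₁ (arc-ends C ab)))) (OnSide-ρσ (onSide (proj₂ (arc-ends C ab))))
        (RenProps.aimg⁺ R' (subA (RenProps.aimg⁺ R ab)))

  walk-stays : ∀ {a b} → Walk D (λ z → z ≢ s) a b → a ∈ V D1 → b ∈ V D1
  walk-stays (stay _ _) a∈ = a∈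
  walk-stays (fwd {a} {w} aw a≢s W) a∈ = walk-stays W (step (to (arcs a w) aw))
    where
    w≢s = proj₂ (walk-start W)
    step : _ → w ∈ V D1
    step (inj₁ (y , z , yz , _ , ez)) =
      subst (_∈ V D1) (sym (trans ez (ren-fixes v1 s z (λ e → w≢s (trans ez e))))) (proj₂ (arc-ends D1 yz))
    step (inj₂ (y , z , yz , ey , _)) =
      ⊥-elim (disjointV a a∈ (subst (_∈ V D2) (sym (trans ey (ren-fixes v2 s y (λ e → a≢s (trans ey e))))) (proj₁ (arc-ends D2 yz))))
  walk-stays (bwd {a} {w} wa a≢s W) a∈ = walk-stays W (step (to (arcs w a) wa))
    where
    w≢s = proj₂ (walk-start W)
    step : _ → w ∈ V D1
    step (inj₁ (y , z , yz , ey , _)) =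
      subst (_∈ V D1) (sym (trans ey (ren-fixes v1 s y (λ e → w≢s (trans ey e))))) (proj₁ (arc-ends D1 yz))
    step (inj₂ (y , z , yz , _ , ez)) =
      ⊥-elim (disjointV a a∈ (subst (_∈ V D2) (sym (trans ez (ren-fixes v2 s z (λ e → a≢s (trans ez e))))) (proj₂ (arc-ends D2 yz))))

  walk-to-s : ∀ {y} → y ∈ V D1 → Walk D (λ _ → ⊤) (ρ y) s
  walk-to-s {y} y∈ = subst (Walk D (λ _ → ⊤) (ρ y)) (ren-eq v1 s)
    (walk-map ρ ρV ρA (λ _ _ → tt) (proj₂ connectedD y v1 y∈ v1∈))

  X-at-s⁺ : ∀ {x} → x ∈ X1 v1 → ∃ λ p → (p ∈ pieces) × (s ∈ V (P (rename p))) × (x ∈ XP (rename p) s)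
  X-at-s⁺ {x} x∈ with to (union-X v1 v1∈ x) x∈
  ... | p , m , v1∈p , x∈p = p , m , subst (_∈ V (P (rename p))) (ren-eq v1 s) (RenProps.vimg⁺ (rename-Ren m) v1∈p) ,
                                    subst (λ t → x ∈ XP p t) (sym (ren-eq s v1)) x∈p

  X-at-s⁻ : ∀ {p x} → p ∈ pieces → s ∈ V (P (rename p)) → x ∈ XP (rename p) s → x ∈ X1 v1
  X-at-s⁻ {p} {x} m s∈ x∈ = from (union-X v1 v1∈ x)
    (p , m , subst (_∈ V (P p)) (ren-eq s v1) (RenProps.σV (rename-Ren m) s∈) , subst (λ t → x ∈ XP p t) (ren-eq s v1) x∈)

  X-away⁺ : ∀ {v x} → v ∈ V D1 → v ≢ v1 → x ∈ X1 v → ∃ λ p → (p ∈ pieces) × (v ∈ V (P (rename p))) × (x ∈ XP (rename p) v)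
  X-away⁺ {v} {x} v∈ v≢v1 x∈ with to (union-X v v∈ x) x∈
  ... | p , m , v∈p , x∈p = p , m , subst (_∈ V (P (rename p))) (ren-neq v1 s v v≢v1) (RenProps.vimg⁺ (rename-Ren m) v∈p) ,
                                    subst (λ t → x ∈ XP p t) (sym (ren-neq s v1 v (≢s v∈))) x∈p

  X-away⁻ : ∀ {p v x} → p ∈ pieces → v ∈ V D1 → v ∈ V (P (rename p)) → x ∈ XP (rename p) v → x ∈ X1 v
  X-away⁻ {p} {v} {x} m v∈ v∈p x∈ = from (union-X v v∈ x)
    (p , m , subst (_∈ V (P p)) (ren-neq s v1 v (≢s v∈)) (RenProps.σV (rename-Ren m) v∈p) ,
     subst (λ t → x ∈ XP p t) (ren-neq s v1 v (≢s v∈)) x∈)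

  not-on-other-side : ∀ {p v} → p ∈ pieces → v ∈ V D2 → v ∉ V (P (rename p))
  not-on-other-side {p} {v} m v∈ v∈p with RenProps.vimg⁻ (rename-Ren m) v∈p
  ... | y , y∈p , v≡ρy = cases (y ≟ v1)
    where
    y∈ = proj₁ (IsPiece.sub (isPiece m)) y∈p
    cases : Dec (y ≡ v1) → ⊥
    cases (yes y≡v1) = s∉D2 (subst (_∈ V D2) (trans v≡ρy (subst (λ t → ρ t ≡ s) (sym y≡v1) (ren-eq v1 s))) v∈)
    cases (no y≢v1) = disjointV y y∈ (subst (_∈ V D2) (trans v≡ρy (ren-neq v1 s y y≢v1)) v∈)

module MergeDecompositions {D1 X1 H1 D2 X2 H2 v1 v2 s D X H} (M : Merging D1 X1 H1 D2 X2 H2 v1 v2 s D X H)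
                           (I1 : PieceDecomposition D1 X1 H1) (I2 : PieceDecomposition D2 X2 H2) where
  module S1 = MergeSide M I1
  module S2 = MergeSide (swapMerging M) I2
  open Merging M
  pieces1 = PieceDecomposition.pieces I1
  pieces2 = PieceDecomposition.pieces I2

  pieces : List Piece
  pieces = map S1.rename pieces1 ++ map S2.rename pieces2

  which-side : ∀ {p} → p ∈ pieces → (∃ λ q → (q ∈ pieces1) × (p ≡ S1.rename q)) ⊎ (∃ λ q → (q ∈ pieces2) × (p ≡ S2.rename q))
  which-side m with ∈-++⁻ (map S1.rename pieces1) m
  ... | inj₁ m1 = inj₁ (∈-map⁻ S1.rename m1)
  ... | inj₂ m2 = inj₂ (∈-map⁻ S2.rename m2)

  from-side1 : ∀ {q} → q ∈ pieces1 → S1.rename q ∈ pieces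
  from-side1 m = ∈-++⁺ˡ (∈-map⁺ S1.rename m)

  from-side2 : ∀ {q} → q ∈ pieces2 → S2.rename q ∈ pieces
  from-side2 m = ∈-++⁺ʳ (map S1.rename pieces1) (∈-map⁺ S2.rename m)

  isPiece : ∀ {p} → p ∈ pieces → IsPiece D p
  isPiece m with which-side m
  ... | inj₁ (q , mq , refl) = S1.rename-isPiece mq
  ... | inj₂ (q , mq , refl) = S2.rename-isPiece mq

  s∈D : s ∈ V D
  s∈D = from (vertices s) (inj₁ (v1 , v1∈ , sym (ren-eq v1 s)))

  walk-to-s : ∀ {x} → x ∈ V D → Walk D (λ _ → ⊤) x s
  walk-to-s {x} x∈ with to (vertices x) x∈
  ... | inj₁ (y , y∈ , refl) = S1.walk-to-s y∈
  ... | inj₂ (y , y∈ , refl) = S2.walk-to-s y∈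

  connectedD : Connected D
  connectedD = (s , s∈D) , λ u w u∈ w∈ → walk-++ (walk-to-s u∈) (walk-rev (walk-to-s w∈))

  unrenamed : ∀ {G} v {y} → y ∈ V G → ren v s y ≢ s → (ren v s y ∈ V G) × (ren v s y ≢ v)
  unrenamed {G} v {y} y∈ ≢s = subst (_∈ V G) (sym (ren-fixes v s y ≢s)) y∈ ,
                              λ e → ren-moves v s y ≢s (trans (sym (ren-fixes v s y ≢s)) e)

  classify : ∀ {x} → x ∈ V D → x ≢ s → ((x ∈ V D1) × (x ≢ v1)) ⊎ ((x ∈ V D2) × (x ≢ v2))
  classify {x} x∈ x≢s with to (vertices x) x∈
  ... | inj₁ (y , y∈ , refl) = inj₁ (unrenamed {D1} v1 y∈ x≢s)
  ... | inj₂ (y , y∈ , refl) = inj₂ (unrenamed {D2} v2 y∈ x≢s)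

  -- a 2-connected subdigraph of D cannot have vertices strictly on both
  -- sides: s would separate them (or, if absent, they would be disconnected)
  no-straddle : ∀ C → Sub C D → Connected C → NoSepVertex C →
                ∀ {a b} → a ∈ V C → b ∈ V C → a ∈ V D1 → b ∈ V D2 → ⊥
  no-straddle C (subV , subA) conC nsC {a} {b} a∈C b∈C a∈ b∈ with s ∈ℕ? V C
  ... | yes s∈C = nsC s (s∈C , a , b , a∈C , b∈C , S1.≢s a∈ , S2.≢s b∈ ,
          λ W → disjointV b (S1.walk-stays (walk-map (λ z → z) subV subA (λ _ z≢s → z≢s) W) a∈) b∈)
  ... | no s∉C = disjointV b (S1.walk-stays (walk-map (λ z → z) subV subA
          (λ z∈ _ z≡s → s∉C (subst (_∈ V C) z≡s z∈)) (proj₂ conC a b a∈C b∈C)) a∈) b∈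

  strictlyOnD1? : (x : ℕ) → Dec ((x ∈ V D1) × (x ≢ v1))
  strictlyOnD1? x = (x ∈ℕ? V D1) ×-dec ¬? (x ≟ v1)

  maximal : ∀ C → Sub C D → Connected C → NoSepVertex C → (∃ λ a → a ∈ A C) →
            ∃ λ p → (p ∈ pieces) × Sub C (P p)
  maximal C subC conC nsC arcC with any? strictlyOnD1? (V C)
  ... | yes some = let (q , mq , sub) = S1.OnThisSide.inside-piece C subC onSide1 conC nsC arcC
                   in S1.rename q , from-side1 mq , sub
    where
    x₀ = proj₁ (find-∈ some)
    x₀∈C = proj₁ (proj₂ (find-∈ some))
    x₀∈D1 = proj₁ (proj₂ (proj₂ (find-∈ some)))
    onSide1 : ∀ {x} → x ∈ V C → S1.OnSide x
    onSide1 {x} x∈ with x ≟ s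
    ... | yes x≡s = inj₁ x≡s
    ... | no x≢s with classify (proj₁ subC x∈) x≢s
    ...   | inj₁ on1 = inj₂ on1
    ...   | inj₂ (x∈D2 , _) = ⊥-elim (no-straddle C subC conC nsC x₀∈C x∈ x₀∈D1 x∈D2)
  ... | no none = let (q , mq , sub) = S2.OnThisSide.inside-piece C subC onSide2 conC nsC arcC
                  in S2.rename q , from-side2 mq , sub
    where
    onSide2 : ∀ {x} → x ∈ V C → S2.OnSide x
    onSide2 {x} x∈ with x ≟ s
    ... | yes x≡s = inj₁ x≡s
    ... | no x≢s with classify (proj₁ subC x∈) x≢s
    ...   | inj₁ on1 = ⊥-elim (none (lose-∈ x∈ on1))
    ...   | inj₂ on2 = inj₂ on2

  no-common-arc : ∀ {p q a} → p ∈ pieces1 → q ∈ pieces2 → a ∈ A (P (S1.rename p)) → a ∈ A (P (S2.rename q)) → ⊥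
  no-common-arc {p} {q} mp mq ap aq with RenProps.aimg⁻ (S1.rename-Ren mp) ap | RenProps.aimg⁻ (S2.rename-Ren mq) aq
  ... | y , z , yz , refl , refl | y' , z' , yz' , ey , ez =
    loopless (P (S1.rename p)) (subst₂ (λ u w → (u , w) ∈ A (P (S1.rename p)))
      (S1.meet-at-s (inD1 (proj₁ (arc-ends (P p) yz))) (inD2 (proj₁ (arc-ends (P q) yz'))) ey)
      (S1.meet-at-s (inD1 (proj₂ (arc-ends (P p) yz))) (inD2 (proj₂ (arc-ends (P q) yz'))) ez) ap)
    where
    inD1 = proj₁ (IsPiece.sub (PieceDecomposition.isPiece I1 mp))
    inD2 = proj₁ (IsPiece.sub (PieceDecomposition.isPiece I2 mq))

  arc-unique : ∀ {p q} → p ∈ pieces → q ∈ pieces → ∀ a → a ∈ A (P p) → a ∈ A (P q) →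
               (P p ≅ P q) × SameCover (P p) (XP p) (HP p) (XP q) (HP q)
  arc-unique mp mq a ap aq with which-side mp | which-side mq
  ... | inj₁ (_ , mp' , refl) | inj₁ (_ , mq' , refl) = S1.rename-arc-unique mp' mq' a ap aq
  ... | inj₂ (_ , mp' , refl) | inj₂ (_ , mq' , refl) = S2.rename-arc-unique mp' mq' a ap aq
  ... | inj₁ (_ , mp' , refl) | inj₂ (_ , mq' , refl) = ⊥-elim (no-common-arc mp' mq' ap aq)
  ... | inj₂ (_ , mp' , refl) | inj₁ (_ , mq' , refl) = ⊥-elim (no-common-arc mq' mp' aq ap)

  H-disjoint : ∀ {p q} → p ∈ pieces → q ∈ pieces → ¬ (P p ≅ P q) → ∀ x → x ∈ V (HP p) → x ∉ V (HP q)
  H-disjoint mp mq ne x with which-side mp | which-side mq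
  ... | inj₁ (_ , mp' , refl) | inj₁ (_ , mq' , refl) = S1.rename-H-disjoint mp' mq' ne x
  ... | inj₂ (_ , mp' , refl) | inj₂ (_ , mq' , refl) = S2.rename-H-disjoint mp' mq' ne x
  ... | inj₁ (_ , mp' , refl) | inj₂ (_ , mq' , refl) = λ x∈p x∈q → disjointH x (S1.piece-V-H1 mp' x∈p) (S2.piece-V-H1 mq' x∈q)
  ... | inj₂ (_ , mp' , refl) | inj₁ (_ , mq' , refl) = λ x∈p x∈q → disjointH x (S1.piece-V-H1 mq' x∈q) (S2.piece-V-H1 mp' x∈p)

  union-V : ∀ x → (x ∈ V H) ⇔ (∃ λ p → (p ∈ pieces) × (x ∈ V (HP p)))
  union-V x = mk⇔ forth back
    where
    forth : x ∈ V H → ∃ λ p → (p ∈ pieces) × (x ∈ V (HP p))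
    forth x∈ with to (verticesH x) x∈
    ... | inj₁ x∈H1 = let (q , mq , x∈q) = to (PieceDecomposition.union-V I1 x) x∈H1 in S1.rename q , from-side1 mq , x∈q
    ... | inj₂ x∈H2 = let (q , mq , x∈q) = to (PieceDecomposition.union-V I2 x) x∈H2 in S2.rename q , from-side2 mq , x∈q
    back : (∃ λ p → (p ∈ pieces) × (x ∈ V (HP p))) → x ∈ V H
    back (p , mp , x∈p) with which-side mp
    ... | inj₁ (q , mq , refl) = from (verticesH x) (inj₁ (S1.piece-V-H1 mq x∈p))
    ... | inj₂ (q , mq , refl) = from (verticesH x) (inj₂ (S2.piece-V-H1 mq x∈p))

  union-A : ∀ a → (a ∈ A H) ⇔ (∃ λ p → (p ∈ pieces) × (a ∈ A (HP p)))
  union-A a = mk⇔ forth back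
    where
    forth : a ∈ A H → ∃ λ p → (p ∈ pieces) × (a ∈ A (HP p))
    forth a∈ with to (arcsH a) a∈
    ... | inj₁ a∈H1 = let (q , mq , a∈q) = to (PieceDecomposition.union-A I1 a) a∈H1 in S1.rename q , from-side1 mq , a∈q
    ... | inj₂ a∈H2 = let (q , mq , a∈q) = to (PieceDecomposition.union-A I2 a) a∈H2 in S2.rename q , from-side2 mq , a∈q
    back : (∃ λ p → (p ∈ pieces) × (a ∈ A (HP p))) → a ∈ A H
    back (p , mp , a∈p) with which-side mp
    ... | inj₁ (q , mq , refl) = from (arcsH a) (inj₁ (S1.piece-A-H1 mq a∈p))
    ... | inj₂ (q , mq , refl) = from (arcsH a) (inj₂ (S2.piece-A-H1 mq a∈p))

  InPieces : ℕ → ℕ → Set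
  InPieces v x = ∃ λ p → (p ∈ pieces) × (v ∈ V (P p)) × (x ∈ XP p v)

  union-X-at-s : ∀ x → (x ∈ X s) ⇔ InPieces s x
  union-X-at-s x = mk⇔ forth back
    where
    forth : x ∈ X s → InPieces s x
    forth x∈ with to (X-at-s x) x∈
    ... | inj₁ x∈1 = let (q , mq , r) = S1.X-at-s⁺ x∈1 in S1.rename q , from-side1 mq , r
    ... | inj₂ x∈2 = let (q , mq , r) = S2.X-at-s⁺ x∈2 in S2.rename q , from-side2 mq , r
    back : InPieces s x → x ∈ X s
    back (p , mp , s∈p , x∈p) with which-side mp
    ... | inj₁ (q , mq , refl) = from (X-at-s x) (inj₁ (S1.X-at-s⁻ mq s∈p x∈p))
    ... | inj₂ (q , mq , refl) = from (X-at-s x) (inj₂ (S2.X-at-s⁻ mq s∈p x∈p))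

  union-X-on-D1 : ∀ {v} → v ∈ V D1 → v ≢ v1 → ∀ x → (x ∈ X v) ⇔ InPieces v x
  union-X-on-D1 {v} v∈ v≢v1 x = mk⇔ forth back
    where
    forth : x ∈ X v → InPieces v x
    forth x∈ = let (q , mq , r) = S1.X-away⁺ v∈ v≢v1 (to (X-on-D1 v v∈ v≢v1 x) x∈) in S1.rename q , from-side1 mq , r
    back : InPieces v x → x ∈ X v
    back (p , mp , v∈p , x∈p) with which-side mp
    ... | inj₁ (q , mq , refl) = from (X-on-D1 v v∈ v≢v1 x) (S1.X-away⁻ mq v∈ v∈p x∈p)
    ... | inj₂ (q , mq , refl) = ⊥-elim (S2.not-on-other-side mq v∈ v∈p)

  union-X-on-D2 : ∀ {v} → v ∈ V D2 → v ≢ v2 → ∀ x → (x ∈ X v) ⇔ InPieces v x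
  union-X-on-D2 {v} v∈ v≢v2 x = mk⇔ forth back
    where
    forth : x ∈ X v → InPieces v x
    forth x∈ = let (q , mq , r) = S2.X-away⁺ v∈ v≢v2 (to (X-on-D2 v v∈ v≢v2 x) x∈) in S2.rename q , from-side2 mq , r
    back : InPieces v x → x ∈ X v
    back (p , mp , v∈p , x∈p) with which-side mp
    ... | inj₂ (q , mq , refl) = from (X-on-D2 v v∈ v≢v2 x) (S2.X-away⁻ mq v∈ v∈p x∈p)
    ... | inj₁ (q , mq , refl) = ⊥-elim (S1.not-on-other-side mq v∈ v∈p)

  union-X : ∀ v → v ∈ V D → ∀ x → (x ∈ X v) ⇔ InPieces v x
  union-X v v∈ x with v ≟ s
  ... | yes refl = union-X-at-s x
  ... | no v≢s with classify v∈ v≢s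
  ...   | inj₁ (v∈D1 , v≢v1) = union-X-on-D1 v∈D1 v≢v1 x
  ...   | inj₂ (v∈D2 , v≢v2) = union-X-on-D2 v∈D2 v≢v2 x

  decomposition : PieceDecomposition D X H
  decomposition = record
    { pieces = pieces ; isPiece = isPiece ; connectedD = connectedD ; maximal = maximal
    ; arc-unique = arc-unique ; H-disjoint = H-disjoint
    ; union-V = union-V ; union-A = union-A ; union-X = union-X }

constructible-decomposition : ∀ {D X H} → Constructible D X H → PieceDecomposition D X H
constructible-decomposition (base-K f k) = basic-decomposition f (inj₁ k)
constructible-decomposition (base-C f c) = basic-decomposition f (inj₂ (inj₁ c))
constructible-decomposition (base-BC f b) = basic-decomposition f (inj₂ (inj₂ b))
constructible-decomposition (merge c1 c2 m) =
  MergeDecompositions.decomposition (toMerging m) (constructible-decomposition c1) (constructible-decomposition c2)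

findPiece : List Piece → Digraph → Maybe Piece
findPiece [] B = nothing
findPiece (p ∷ ps) B with ≅? (P p) B
... | yes _ = just p
... | no _ = findPiece ps B

findPiece-just : ∀ ps B {p} → findPiece ps B ≡ just p → (p ∈ ps) × (P p ≅ B)
findPiece-just (q ∷ ps) B e with ≅? (P q) B
findPiece-just (q ∷ ps) B refl | yes q≅B = here refl , q≅B
... | no _ = let (m , p≅B) = findPiece-just ps B e in there m , p≅B

findPiece-nothing : ∀ ps B → findPiece ps B ≡ nothing → ∀ {p} → p ∈ ps → ¬ (P p ≅ B)
findPiece-nothing (q ∷ ps) B e m with ≅? (P q) B
findPiece-nothing (q ∷ ps) B () m | yes _
findPiece-nothing (q ∷ ps) B e (here refl) | no q≇B = q≇B
findPiece-nothing (q ∷ ps) B e (there m) | no _ = findPiece-nothing ps B e m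

findPiece-≅ : ∀ ps {B B'} → B ≅ B' → findPiece ps B ≡ findPiece ps B'
findPiece-≅ [] e = refl
findPiece-≅ (q ∷ ps) {B} {B'} e with ≅? (P q) B | ≅? (P q) B'
... | yes _ | yes _ = refl
... | yes q≅B | no q≇B' = ⊥-elim (q≇B' (≅-trans {P q} {B} {B'} q≅B e))
... | no q≇B | yes q≅B' = ⊥-elim (q≇B (≅-trans {P q} {B'} {B} q≅B' (≅-sym {B} {B'} e)))
... | no _ | no _ = findPiece-≅ ps e

findPiece-view : ∀ ps B → (∃ λ p → findPiece ps B ≡ just p) ⊎ (findPiece ps B ≡ nothing)
findPiece-view ps B with findPiece ps B
... | just p = inj₁ (p , refl)
... | nothing = inj₂ refl

nonempty? : {A : Set} (l : List A) → (∃ λ a → a ∈ l) ⊎ (∀ a → a ∉ l)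
nonempty? [] = inj₂ (λ _ ())
nonempty? (a ∷ _) = inj₁ (a , here refl)

coverX : Maybe Piece → ℕ → List ℕ
coverX (just p) = XP p
coverX nothing = λ _ → []

coverH : Maybe Piece → Digraph
coverH (just p) = HP p
coverH nothing = emptyDigraph

module BlocksFromPieces {D X H} (I : PieceDecomposition D X H) where
  open PieceDecomposition I using (pieces; isPiece; maximal; arc-unique; H-disjoint)

  piece-noSepVertex : ∀ {p} → p ∈ pieces → NoSepVertex (P p)
  piece-noSepVertex {p} m = config-noSepVertex {P p} {XP p} {HP p} (IsPiece.conf (isPiece m))

  piece-isBlock : ∀ {p} → p ∈ pieces → IsBlock D (P p)
  piece-isBlock {p} m = sub , connected , piece-noSepVertex m , maximality
    where
    open IsPiece (isPiece m)
    maximality : ∀ B' → Sub (P p) B' → Sub B' D → Connected B' → NoSepVertex B' → Sub B' (P p)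
    maximality B' p⊆B' B'⊆D conB' nsB' with arc
    ... | a , a∈p with maximal B' B'⊆D conB' nsB' (a , proj₂ p⊆B' a∈p)
    ... | q , mq , B'⊆q = Sub-trans {B'} {P q} {P p} B'⊆q
          (≅⇒Sub {P q} {P p} (≅-sym {P p} {P q} (proj₁ (arc-unique m mq a a∈p (proj₂ B'⊆q (proj₂ p⊆B' a∈p))))))

  block-piece : ∀ B → IsBlock D B → (∃ λ p → (p ∈ pieces) × (P p ≅ B)) ⊎ (∀ a → a ∉ A B)
  block-piece B (B⊆D , conB , nsB , maxB) with nonempty? (A B)
  ... | inj₂ noArc = inj₂ noArc
  ... | inj₁ arcB with maximal B B⊆D conB nsB arcB
  ...   | p , m , B⊆p = inj₁ (p , m , Sub-antisym {P p} {B}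
          (maxB (P p) B⊆p (IsPiece.sub (isPiece m)) (IsPiece.connected (isPiece m)) (piece-noSepVertex m)) B⊆p)

  blocks-sharing-arc : ∀ B B' → IsBlock D B → IsBlock D B' → ∀ a → a ∈ A B → a ∈ A B' → B ≅ B'
  blocks-sharing-arc B B' bB bB' a a∈B a∈B' with block-piece B bB | block-piece B' bB'
  ... | inj₂ noArc | _ = ⊥-elim (noArc a a∈B)
  ... | inj₁ _ | inj₂ noArc = ⊥-elim (noArc a a∈B')
  ... | inj₁ (p , m , p≅B) | inj₁ (q , m' , q≅B') =
    ≅-trans {B} {P p} {B'} (≅-sym {P p} {B} p≅B)
      (≅-trans {P p} {P q} {B'} (proj₁ (arc-unique m m' a (from (proj₂ p≅B a) a∈B) (from (proj₂ q≅B' a) a∈B'))) q≅B')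

  XB : Digraph → ℕ → List ℕ
  XB B = coverX (findPiece pieces B)

  HB : Digraph → Digraph
  HB B = coverH (findPiece pieces B)

  lookup-piece : ∀ {p} → p ∈ pieces →
    ∃ λ q → (findPiece pieces (P p) ≡ just q) × SameCover (P p) (XP p) (HP p) (XP q) (HP q)
  lookup-piece {p} m with findPiece-view pieces (P p)
  ... | inj₂ e = ⊥-elim (findPiece-nothing pieces (P p) e m (≅-refl {P p}))
  ... | inj₁ (q , e) with findPiece-just pieces (P p) e | IsPiece.arc (isPiece m)
  ... | mq , q≅p | a , a∈p = q , e , proj₂ (arc-unique m mq a a∈p (from (proj₂ q≅p a) a∈p))

  well-defined : ∀ B B' → IsBlock D B → IsBlock D B' → B ≅ B' → SameCover B (XB B) (HB B) (XB B') (HB B')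
  well-defined B B' _ _ e rewrite findPiece-≅ pieces {B} {B'} e = (λ _ _ → ≋-refl) , ≅-refl {HB B'}

  cover : ∀ B → IsBlock D B → IsCover B (XB B) (HB B)
  cover B _ with findPiece-view pieces B
  ... | inj₁ (p , e) rewrite e = let (m , p≅B) = findPiece-just pieces B e in
                                 Transport.cover (idRen {P p} {B} p≅B) {XP p} {HP p} (IsPiece.cover (isPiece m))
  ... | inj₂ e rewrite e = emptyCover B

  typ : ∀ B → IsBlock D B → Config B (XB B) (HB B)
  typ B bB with findPiece-view pieces B
  ... | inj₁ (p , e) rewrite e = let (m , p≅B) = findPiece-just pieces B e in
                                 Transport.config (idRen {P p} {B} p≅B) {XP p} {HP p} (IsPiece.conf (isPiece m))
  ... | inj₂ e rewrite e with block-piece B bB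
  ...   | inj₁ (p , m , p≅B) = ⊥-elim (findPiece-nothing pieces B e m p≅B)
  ...   | inj₂ noArc = inj₁ (arcless-kConfig B (proj₁ (proj₂ bB)) noArc)

  pairwise-disjoint : ∀ B B' → IsBlock D B → IsBlock D B' → ¬ (B ≅ B') → ∀ x → x ∈ V (HB B) → x ∉ V (HB B')
  pairwise-disjoint B B' _ _ B≇B' x with findPiece-view pieces B | findPiece-view pieces B'
  ... | inj₂ e | _ rewrite e = λ ()
  ... | inj₁ _ | inj₂ e' rewrite e' = λ _ ()
  ... | inj₁ (p , e) | inj₁ (q , e') rewrite e | e' =
    let (m , p≅B) = findPiece-just pieces B e ; (m' , q≅B') = findPiece-just pieces B' e' in
    H-disjoint m m' (λ p≅q → B≇B' (≅-trans {B} {P p} {B'} (≅-sym {P p} {B} p≅B) (≅-trans {P p} {P q} {B'} p≅q q≅B'))) x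

  -- This turns the unions over pieces into the unions over blocks.
  pieces-to-blocks : (Q : Digraph → (ℕ → List ℕ) → Digraph → Set) →
    (∀ {B B' X X' H H'} → B ≅ B' → SameCover B X H X' H' → Q B X H → Q B' X' H') →
    (∀ B → ¬ Q B (λ _ → []) emptyDigraph) →
    (∃ λ p → (p ∈ pieces) × Q (P p) (XP p) (HP p)) ⇔ (∃ λ B → IsBlock D B × Q B (XB B) (HB B))
  pieces-to-blocks Q Q-resp Q-empty = mk⇔ forth back
    where
    forth : (∃ λ p → (p ∈ pieces) × Q (P p) (XP p) (HP p)) → ∃ λ B → IsBlock D B × Q B (XB B) (HB B)
    forth (p , m , q) with lookup-piece m
    ... | p' , e , same = P p , piece-isBlock m ,
          subst (λ r → Q (P p) (coverX r) (coverH r)) (sym e) (Q-resp (≅-refl {P p}) same q)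
    back : (∃ λ B → IsBlock D B × Q B (XB B) (HB B)) → ∃ λ p → (p ∈ pieces) × Q (P p) (XP p) (HP p)
    back (B , bB , q) with findPiece-view pieces B
    ... | inj₂ e rewrite e = ⊥-elim (Q-empty B q)
    ... | inj₁ (p , e) rewrite e = let (m , p≅B) = findPiece-just pieces B e in
          p , m , Q-resp (≅-sym {P p} {B} p≅B) ((λ _ _ → ≋-refl) , ≅-refl {HP p}) q

  union-V : ∀ x → (x ∈ V H) ⇔ (∃ λ B → IsBlock D B × (x ∈ V (HB B)))
  union-V x = ⇔.trans (PieceDecomposition.union-V I x)
    (pieces-to-blocks (λ _ _ H' → x ∈ V H') (λ _ (_ , eV , _) → to (eV x)) (λ _ ()))

  union-A : ∀ a → (a ∈ A H) ⇔ (∃ λ B → IsBlock D B × (a ∈ A (HB B)))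
  union-A a = ⇔.trans (PieceDecomposition.union-A I a)
    (pieces-to-blocks (λ _ _ H' → a ∈ A H') (λ _ (_ , _ , eA) → to (eA a)) (λ _ ()))

  union-X : ∀ v → v ∈ V D → ∀ x → (x ∈ X v) ⇔ (∃ λ B → IsBlock D B × (v ∈ V B) × (x ∈ XB B v))
  union-X v v∈ x = ⇔.trans (PieceDecomposition.union-X I v v∈ x)
    (pieces-to-blocks (λ B X' _ → (v ∈ V B) × (x ∈ X' v))
      (λ (eV , _) (eX , _) (v∈B , x∈) → to (eV v) v∈B , to (eX v v∈B x) x∈)
      (λ { _ (_ , ()) }))

  decomposition : BlockDecomposition D X H XB HB
  decomposition = record
    { well-defined = well-defined ; cover = cover ; typ = typ ; pairwise-disjoint = pairwise-disjoint
    ; union-V = union-V ; union-A = union-A ; union-X = union-X }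

ArcsDetermineBlocks : Digraph → Set
ArcsDetermineBlocks D = ∀ B B' → IsBlock D B → IsBlock D B' → ∀ a → a ∈ A B → a ∈ A B' → B ≅ B'

-- If blocks are determined by their arcs, the cover of each block in a block
-- decomposition is determined by (X, H) alone: the arcs of H^B are the arcs
-- of H between X_u and X_w for arcs uw of B, and X^B_v consists of the
-- x ∈ X_v with an H-arc into X_w for some arc vw of B (such an arc exists
-- because every vertex of a configuration has an out-neighbour).
module RecoverCover {D X H XB HB} (arcs-determine : ArcsDetermineBlocks D)
                    (Dc : BlockDecomposition D X H XB HB) where
  open BlockDecomposition Dc

  ArcOver : Digraph → ℕ × ℕ → Set
  ArcOver B (x , y) = ((x , y) ∈ A H) × ∃₂ λ u w → ((u , w) ∈ A B) × (x ∈ X u) × (y ∈ X w)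

  LeavesAlong : Digraph → ℕ → ℕ → Set
  LeavesAlong B v x = (x ∈ X v) × ∃₂ λ y w → ((x , y) ∈ A H) × ((v , w) ∈ A B) × (y ∈ X w)

  XB⊆X : ∀ B → IsBlock D B → ∀ {v x} → v ∈ V B → x ∈ XB B v → x ∈ X v
  XB⊆X B bB {v} {x} v∈ x∈ = from (union-X v (proj₁ (proj₁ bB) v∈) x) (B , bB , v∈ , x∈)

  -- the sets X_v are pairwise disjoint (the local covers are, and blocks'
  -- covers do not overlap)
  X-disjoint : ∀ u v x → u ∈ V D → v ∈ V D → x ∈ X u → x ∈ X v → u ≡ v
  X-disjoint u v x u∈ v∈ xu xv with u ≟ v
  ... | yes u≡v = u≡v
  ... | no _ with to (union-X u u∈ x) xu | to (union-X v v∈ x) xv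
  ... | B , bB , u∈B , xu' | B' , bB' , v∈B' , xv' with ≅? B B'
  ... | yes B≅B' = IsCover.disjoint (cover B bB) u v x u∈B v∈B xu'
                     (from (proj₁ (well-defined B B' bB bB' B≅B') v v∈B x) xv')
    where v∈B = from (proj₁ B≅B' v) v∈B'
  ... | no B≇B' = ⊥-elim (pairwise-disjoint B B' bB bB' B≇B' x
                     (from (IsCover.vertices (cover B bB) x) (u , u∈B , xu'))
                     (from (IsCover.vertices (cover B' bB') x) (v , v∈B' , xv')))

  arcs-char : ∀ B → IsBlock D B → ∀ a → (a ∈ A (HB B)) ⇔ ArcOver B a
  arcs-char B bB (x , y) = mk⇔ forth back
    where
    forth : (x , y) ∈ A (HB B) → ArcOver B (x , y)
    forth xy with IsCover.origin (cover B bB) x y xy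
    ... | u , w , uw , xu , yw = from (union-A _) (B , bB , xy) , u , w , uw ,
          XB⊆X B bB (proj₁ (arc-ends B uw)) xu , XB⊆X B bB (proj₂ (arc-ends B uw)) yw
    -- an arc of H over uw lies in the H^B' of some block B' containing an
    -- arc over uw as well, and then B' = B
    back : ArcOver B (x , y) → (x , y) ∈ A (HB B)
    back (xy , u , w , uw , xu , yw) with to (union-A _) xy
    ... | B' , bB' , xy' with IsCover.origin (cover B' bB') x y xy'
    ... | u' , w' , u'w' , xu' , yw' = to (proj₂ (proj₂ (well-defined B' B bB' bB B'≅B)) (x , y)) xy'
      where
      inD = proj₁ (proj₁ bB)
      inD' = proj₁ (proj₁ bB')
      u'≡u : u' ≡ u
      u'≡u = X-disjoint u' u x (inD' (proj₁ (arc-ends B' u'w'))) (inD (proj₁ (arc-ends B uw)))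
               (XB⊆X B' bB' (proj₁ (arc-ends B' u'w')) xu') xu
      w'≡w : w' ≡ w
      w'≡w = X-disjoint w' w y (inD' (proj₂ (arc-ends B' u'w'))) (inD (proj₂ (arc-ends B uw)))
               (XB⊆X B' bB' (proj₂ (arc-ends B' u'w')) yw') yw
      B'≅B : B' ≅ B
      B'≅B = arcs-determine B' B bB' bB (u , w) (subst₂ (λ a b → (a , b) ∈ A B') u'≡u w'≡w u'w') uw

  X-char : ∀ B → IsBlock D B → ∀ v → v ∈ V B → ∀ x → (x ∈ XB B v) ⇔ LeavesAlong B v x
  X-char B bB v v∈ x = mk⇔ forth back
    where
    inD = proj₁ (proj₁ bB)
    forth : x ∈ XB B v → LeavesAlong B v x
    forth x∈ with config-out {B} {XB B} {HB B} (typ B bB) v x v∈ x∈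
    ... | y , xy with IsCover.origin (cover B bB) x y xy
    ... | u , w , uw , xu , yw with IsCover.disjoint (cover B bB) u v x (proj₁ (arc-ends B uw)) v∈ xu x∈
    ... | refl = XB⊆X B bB v∈ x∈ , y , w , from (union-A _) (B , bB , xy) , uw , XB⊆X B bB (proj₂ (arc-ends B uw)) yw
    back : LeavesAlong B v x → x ∈ XB B v
    back (xv , y , w , xy , vw , yw) with IsCover.origin (cover B bB) x y (from (arcs-char B bB (x , y)) (xy , v , w , vw , xv , yw))
    ... | u , _ , uw , xu , _ with X-disjoint u v x (inD (proj₁ (arc-ends B uw))) (inD v∈) (XB⊆X B bB (proj₁ (arc-ends B uw)) xu) xv
    ... | refl = xu

  vertices-char : ∀ B → IsBlock D B → ∀ x → (x ∈ V (HB B)) ⇔ (∃ λ v → (v ∈ V B) × LeavesAlong B v x)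
  vertices-char B bB x = ⇔.trans (IsCover.vertices (cover B bB) x)
    (mk⇔ (λ (v , v∈ , x∈) → v , v∈ , to (X-char B bB v v∈ x) x∈)
         (λ (v , v∈ , l) → v , v∈ , from (X-char B bB v v∈ x) l))

blockDecomposition-unique : ∀ {D X H XB₁ HB₁ XB₂ HB₂} → ArcsDetermineBlocks D →
  BlockDecomposition D X H XB₁ HB₁ → BlockDecomposition D X H XB₂ HB₂ →
  ∀ B → IsBlock D B → SameCover B (XB₁ B) (HB₁ B) (XB₂ B) (HB₂ B)
blockDecomposition-unique det Dc₁ Dc₂ B bB =
  (λ v v∈ x → ⇔.trans (R₁.X-char B bB v v∈ x) (⇔.sym (R₂.X-char B bB v v∈ x))) ,
  (λ x → ⇔.trans (R₁.vertices-char B bB x) (⇔.sym (R₂.vertices-char B bB x))) ,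
  (λ a → ⇔.trans (R₁.arcs-char B bB a) (⇔.sym (R₂.arcs-char B bB a)))
  where
  module R₁ = RecoverCover det Dc₁
  module R₂ = RecoverCover det Dc₂

-- Existence: the block decomposition read off from the piece decomposition.
-- Uniqueness: by the recovery of covers, as blocks sharing an arc coincide.
proposition6 : ∀ D X H → Constructible D X H →
    Σ[ XB ∈ (Digraph → ℕ → List ℕ) ] Σ[ HB ∈ (Digraph → Digraph) ]
      (BlockDecomposition D X H XB HB
       × (∀ XB' HB' → BlockDecomposition D X H XB' HB' →
          ∀ B → IsBlock D B → SameCover B (XB B) (HB B) (XB' B) (HB' B)))
proposition6 D X H c =
  XB , HB , decomposition , λ XB' HB' Dc' → blockDecomposition-unique blocks-sharing-arc decomposition Dc'
  where open BlocksFromPieces (constructible-decomposition c)
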